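{- Let $m \ge 1$, $n\ge 1$ and let $\mathbb{F}$ be a coefficient ring. Define the subcomplex \[ \Gamma_{m,n} = \{\sigma \in \mathsf{M}_{m,n} : s\bar{1} \notin \sigma \text{ for all } s \in [3,m]\} \] of $\mathsf{M}_{m,n}$. For each $d$ put \[ \hat{P}^{m-1,n-1}_{d} = \bigoplus_{s=3}^m \tilde{H}_{d}(\mathsf{M}_{[m]\setminus \{s\},[2,n]};\mathbb{F}), \] where the summand indexed by $s$ is thought of as $s\bar{1}\otimes \tilde{H}_{d}(\mathsf{M}_{[m]\setminus \{s\},[2,n]};\mathbb{F})$. Then there is a long exact sequence \[ \cdots \to \hat{P}^{m-1,n-1}_{d} \to \tilde{H}_{d}(\Gamma_{m,n};\mathbb{F}) \to \tilde{H}_{d}(\mathsf{M}_{m,n};\mathbb{F}) \to \hat{P}^{m-1,n-1}_{d-1} \to \tilde{H}_{d-1}(\Gamma_{m,n};\mathbb{F}) \to \cdots . \]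
   Context: $K_{m,n}$ is the complete bipartite graph with vertex blocks $[m]=\{1,\dots,m\}$ and $[\bar n]=\{\bar 1,\dots,\bar n\}$ (a disjoint copy of $[n]$). Its edges are written $i\bar{j}$. For finite sets $S\subseteq[m]$ and $T\subseteq[n]$, $\mathsf{M}_{S,T}$ is the simplicial complex of matchings (sets of pairwise vertex-disjoint edges) in the complete bipartite graph with blocks $S$ and $\bar T$. $\mathsf{M}_{m,n}=\mathsf{M}_{[m],[n]}$. For integers $a\le b$, $[a,b]=\{a,\dots,b\}$. Homology is reduced simplicial homology. -}

module Defs where

open import Level using (Level; _⊔_) renaming (suc to lsuc)
open import Algebra.Bundles using (Ring)
open import Data.Nat as ℕ using (ℕ; _≤_; _<_)
open import Data.Integer as ℤ using (ℤ; +_; 1ℤ)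
open import Data.Fin using (Fin; toℕ)
open import Data.List using (List; []; _∷_; _++_; map; length)
open import Data.List.Relation.Unary.All as All using (All; []; _∷_)
open import Data.List.Relation.Unary.All.Properties as AllP using ()
open import Data.List.Relation.Unary.AllPairs using (AllPairs)
import Data.List.Properties as LP
import Data.Product.Properties as PP
open import Data.Product using (Σ; _×_; _,_; proj₁; proj₂)
open import Relation.Binary.Core using (Rel)
open import Relation.Binary.PropositionalEquality using (_≡_; _≢_; refl)
import Relation.Binary.PropositionalEquality
open import Relation.Nullary using (¬_; yes; no)
import Relation.Binary.Reasoning.Setoid as SetoidReasoning

-- Graph-theoretic part.
-- A vertex of K_{m,n} on the left is i : ℕ, on the right j̄ is j : ℕ.
-- An edge i j̄ is the pair (i , j).
Edge : Set
Edge = ℕ × ℕ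

-- An (oriented) simplex is a list of edges; a matching is represented
-- canonically as the list of its edges ordered by strictly increasing
-- left endpoint (this fixes the orientation used for chains).
Simplex : Set
Simplex = List Edge

_≟ₛ_ : (σ τ : Simplex) → Relation.Nullary.Dec (σ ≡ τ)
_≟ₛ_ = LP.≡-dec (PP.≡-dec ℕ._≟_ ℕ._≟_)

VSet : Set₁
VSet = ℕ → Set

[_,_] : ℕ → ℕ → VSet
[ a , b ] i = a ≤ i × i ≤ b

⟦_⟧ : ℕ → VSet
⟦ m ⟧ = [ 1 , m ]

_∖｛_｝ : VSet → ℕ → VSet
(S ∖｛ s ｝) i = S i × i ≢ s

Complex : Set₁
Complex = Simplex → Set

M : VSet → VSet → Complex
M S T σ =
  AllPairs (λ e e′ → proj₁ e < proj₁ e′ × proj₂ e ≢ proj₂ e′) σ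
  × All (λ e → S (proj₁ e) × T (proj₂ e)) σ

Mmn : ℕ → ℕ → Complex
Mmn m n = M ⟦ m ⟧ ⟦ n ⟧

Γ : ℕ → ℕ → Complex
Γ m n σ = Mmn m n σ × All (λ e → ¬ ([ 3 , m ] (proj₁ e) × proj₂ e ≡ 1)) σ

-- Abstract modules (only the operations needed to speak about linear
-- maps and exactness) over a ring R.

module _ {c ℓr : Level} (R : Ring c ℓr) where
  private module R = Ring R

  record FMod (a ℓ : Level) : Set (c ⊔ lsuc (a ⊔ ℓ)) where
    field
      Carrier : Set a
      _≈_     : Rel Carrier ℓ
      0#      : Carrier
      _+_     : Carrier → Carrier → Carrier
      _·_     : R.Carrier → Carrier → Carrier

  record LinMap {a ℓ a′ ℓ′} (A : FMod a ℓ) (B : FMod a′ ℓ′)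
         : Set (c ⊔ a ⊔ ℓ ⊔ a′ ⊔ ℓ′) where
    private
      module A = FMod A
      module B = FMod B
    field
      fun   : A.Carrier → B.Carrier
      cong  : ∀ {x y} → x A.≈ y → fun x B.≈ fun y
      +-hom : ∀ x y → fun (x A.+ y) B.≈ (fun x B.+ fun y)
      ·-hom : ∀ r x → fun (r A.· x) B.≈ (r B.· fun x)
  open LinMap public

  Exact : ∀ {a ℓ a′ ℓ′ a″ ℓ″} {A : FMod a ℓ} {B : FMod a′ ℓ′} {C : FMod a″ ℓ″} →
          LinMap A B → LinMap B C → Set (a ⊔ a′ ⊔ ℓ′ ⊔ ℓ″)
  Exact {A = A} {B} {C} f g =
    (∀ x → fun g (fun f x) C.≈ C.0#)
    × (∀ y → fun g y C.≈ C.0# → Σ A.Carrier λ x → fun f x B.≈ y)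
    where
      module A = FMod A
      module B = FMod B
      module C = FMod C

  ⨁ : ∀ {a ℓ} (k : ℕ) → (Fin k → FMod a ℓ) → FMod a ℓ
  ⨁ k A = record
    { Carrier = (i : Fin k) → FMod.Carrier (A i)
    ; _≈_     = λ x y → ∀ i → FMod._≈_ (A i) (x i) (y i)
    ; 0#      = λ i → FMod.0# (A i)
    ; _+_     = λ x y i → FMod._+_ (A i) (x i) (y i)
    ; _·_     = λ r x i → FMod._·_ (A i) r (x i)
    }

  Chain : Set c
  Chain = List (R.Carrier × Simplex)

  coeff : Chain → Simplex → R.Carrier
  coeff [] τ = R.0#
  coeff ((r , σ) ∷ xs) τ with σ ≟ₛ τ
  ... | yes _ = r R.+ coeff xs τ
  ... | no  _ = coeff xs τ

  scale : R.Carrier → Chain → Chain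
  scale r = map (λ p → (r R.* proj₁ p , proj₂ p))

  -- signed faces: ∂[v₀,…,v_d] = Σᵢ (-1)ⁱ [v₀,…,v̂ᵢ,…,v_d]
  -- (the empty simplex has boundary 0: augmented complex, reduced homology)
  faces : Simplex → Chain
  faces []      = []
  faces (v ∷ σ) = (R.1# , σ) ∷ map (λ p → (R.- proj₁ p , v ∷ proj₂ p)) (faces σ)

  ∂ : Chain → Chain
  ∂ []             = []
  ∂ ((r , σ) ∷ xs) = scale r (faces σ) ++ ∂ xs

  -- chains of dimension d supported on the complex K
  -- (a simplex with k vertices has dimension k - 1; the empty face has
  --  dimension -1, giving the augmented chain complex)
  ChainIn : Complex → ℤ → Chain → Set c
  ChainIn K d = All (λ p → K (proj₂ p) × (+ length (proj₂ p) ≡ d ℤ.+ 1ℤ))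

  IsCycle : Chain → Set ℓr
  IsCycle z = ∀ τ → coeff (∂ z) τ R.≈ R.0#

  record Cycle (K : Complex) (d : ℤ) : Set (c ⊔ ℓr) where
    constructor cycle
    field
      chain : Chain
      inK   : ChainIn K d chain
      cyc   : IsCycle chain
  open Cycle public

  private
    open SetoidReasoning R.setoid

    coeff-++ : ∀ xs ys τ → coeff (xs ++ ys) τ R.≈ coeff xs τ R.+ coeff ys τ
    coeff-++ [] ys τ = R.sym (R.+-identityˡ _)
    coeff-++ ((r , σ) ∷ xs) ys τ with σ ≟ₛ τ
    ... | yes _ = R.trans (R.+-congˡ (coeff-++ xs ys τ)) (R.sym (R.+-assoc _ _ _))
    ... | no  _ = coeff-++ xs ys τ

    coeff-scale : ∀ r xs τ → coeff (scale r xs) τ R.≈ r R.* coeff xs τ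
    coeff-scale r [] τ = R.sym (R.zeroʳ r)
    coeff-scale r ((s , σ) ∷ xs) τ with σ ≟ₛ τ
    ... | yes _ = R.trans (R.+-congˡ (coeff-scale r xs τ)) (R.sym (R.distribˡ r s _))
    ... | no  _ = coeff-scale r xs τ

    ∂-++ : ∀ xs ys → ∂ (xs ++ ys) ≡ ∂ xs ++ ∂ ys
    ∂-++ [] ys = refl
    ∂-++ ((r , σ) ∷ xs) ys rewrite ∂-++ xs ys = Relation.Binary.PropositionalEquality.sym (LP.++-assoc (scale r (faces σ)) (∂ xs) (∂ ys))

    coeff-≡ : ∀ {xs ys} τ → xs ≡ ys → coeff xs τ R.≈ coeff ys τ
    coeff-≡ τ refl = R.refl

    coeff-∂-scale : ∀ r xs τ → coeff (∂ (scale r xs)) τ R.≈ r R.* coeff (∂ xs) τ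
    coeff-∂-scale r [] τ = R.sym (R.zeroʳ r)
    coeff-∂-scale r ((s , σ) ∷ xs) τ = begin
      coeff (scale (r R.* s) (faces σ) ++ ∂ (scale r xs)) τ
        ≈⟨ coeff-++ (scale (r R.* s) (faces σ)) _ τ ⟩
      coeff (scale (r R.* s) (faces σ)) τ R.+ coeff (∂ (scale r xs)) τ
        ≈⟨ R.+-cong (coeff-scale (r R.* s) (faces σ) τ) (coeff-∂-scale r xs τ) ⟩
      (r R.* s) R.* coeff (faces σ) τ R.+ r R.* coeff (∂ xs) τ
        ≈⟨ R.+-congʳ (R.*-assoc r s _) ⟩
      r R.* (s R.* coeff (faces σ) τ) R.+ r R.* coeff (∂ xs) τ
        ≈⟨ R.sym (R.distribˡ r _ _) ⟩
      r R.* (s R.* coeff (faces σ) τ R.+ coeff (∂ xs) τ)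
        ≈⟨ R.*-congˡ (R.+-congʳ (R.sym (coeff-scale s (faces σ) τ))) ⟩
      r R.* (coeff (scale s (faces σ)) τ R.+ coeff (∂ xs) τ)
        ≈⟨ R.*-congˡ (R.sym (coeff-++ (scale s (faces σ)) (∂ xs) τ)) ⟩
      r R.* coeff (scale s (faces σ) ++ ∂ xs) τ ∎

  _+ᶜ_ : ∀ {K d} → Cycle K d → Cycle K d → Cycle K d
  x +ᶜ y = cycle (chain x ++ chain y) (AllP.++⁺ (inK x) (inK y)) λ τ →
    R.trans (coeff-≡ τ (∂-++ (chain x) (chain y)))
      (R.trans (coeff-++ (∂ (chain x)) (∂ (chain y)) τ)
        (R.trans (R.+-cong (cyc x τ) (cyc y τ)) (R.+-identityˡ R.0#)))

  _·ᶜ_ : ∀ {K d} → R.Carrier → Cycle K d → Cycle K d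
  r ·ᶜ x = cycle (scale r (chain x)) (AllP.map⁺ (All.map (λ p → p) (inK x))) λ τ →
    R.trans (coeff-∂-scale r (chain x) τ) (R.trans (R.*-congˡ (cyc x τ)) (R.zeroʳ r))

  0ᶜ : ∀ {K d} → Cycle K d
  0ᶜ = cycle [] [] (λ τ → R.refl)

  H̃ : Complex → ℤ → FMod (c ⊔ ℓr) (c ⊔ ℓr)
  H̃ K d = record
    { Carrier = Cycle K d
    ; _≈_     = λ x y → Σ Chain λ b → ChainIn K (d ℤ.+ 1ℤ) b ×
                  (∀ τ → coeff (∂ b) τ R.≈ coeff (chain x) τ R.- coeff (chain y) τ)
    ; 0#      = 0ᶜ
    ; _+_     = _+ᶜ_
    ; _·_     = _·ᶜ_
    }

  -- P̂^{m-1,n-1}_d = ⨁_{s=3}^{m} H̃_d(M_{[m]∖{s},[2,n]}; R)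
  -- (summand i : Fin (m ∸ 2) corresponds to s = 3 + i)
  P̂ : ℕ → ℕ → ℤ → FMod (c ⊔ ℓr) (c ⊔ ℓr)
  P̂ m n d = ⨁ (m ℕ.∸ 2) λ i → H̃ (M (⟦ m ⟧ ∖｛ 3 ℕ.+ toℕ i ｝) [ 2 , n ]) d

-- The edges s1̄ (s ∈ [3,m]) share the vertex 1̄, so a matching of K_{m,n} contains at most one of
-- them: either none, and it lies in Γ_{m,n}, or exactly s1̄, and removing it leaves a matching of
-- M_{[m]∖{s},[2,n]}. On chains this gives, for each s, the join with s1̄ (attach_s) and its left
-- inverse (detach_s), with ∂ attach_s = id − attach_s ∂ and detach_s ∂ = −∂ detach_s, and every
-- chain c of M_{m,n} splits as c = c|_Γ + Σ_s attach_s (detach_s c). The sequence is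
-- α (w_s)_s = Σ_s w_s, which is a cycle of Γ and the boundary of Σ_s attach_s w_s in M_{m,n},
-- β = inclusion and δ = (detach_s)_s; each exactness statement is a short computation with these
-- identities.

module Submission where

open import Defs
open import Level using (Level)
open import Algebra.Bundles using (Ring)
import Algebra.Properties.Ring as RingProperties
import Algebra.Properties.CommutativeSemigroup as CommutativeSemigroupProperties
open import Data.Empty using (⊥-elim)
open import Data.Nat as ℕ using (ℕ; zero; suc; _∸_; _<_; _<?_; _≤_; _≤?_; z≤n; s≤s)
open import Data.Nat.Properties as ℕ
  using (≤-trans; +-cancelˡ-≡; ∸-monoˡ-≤; <-trans; <-irrefl; <-asym; <⇒≢; n≮n; ≤∧≢⇒<; ≮⇒≥)
open import Data.Integer as ℤ using (ℤ; +_; _-_; 1ℤ)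
import Data.Integer.Properties as ℤ
open import Algebra.Properties.AbelianGroup ℤ.+-0-abelianGroup using (∙-cancelʳ)
open import Data.Fin using (Fin; toℕ; fromℕ<) renaming (zero to fzero; suc to fsuc)
open import Data.Fin.Properties using (toℕ<n; toℕ-injective; toℕ-fromℕ<; suc-injective)
open import Data.Product using (Σ; ∃; _×_; _,_; proj₁; proj₂)
open import Data.Product.Properties using (≡-dec)
open import Data.List using (List; []; _∷_; _++_; map; length; deduplicate)
import Data.List.Properties as List
open import Data.List.Relation.Unary.All as All using (All; []; _∷_)
import Data.List.Relation.Unary.All.Properties as All
open import Data.List.Relation.Unary.Any using (here; there; any?)
open import Data.List.Relation.Unary.AllPairs as AllPairs using (AllPairs; []; _∷_)
open import Data.List.Relation.Unary.Unique.Propositional using (Unique)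
open import Data.List.Relation.Unary.Unique.DecPropositional.Properties using (deduplicate-!)
open import Data.List.Membership.Propositional using (_∈_; _∉_; find)
open import Data.List.Membership.Propositional.Properties using (∈-map⁺; ∈-++⁺ˡ; ∈-++⁺ʳ; ∈-deduplicate⁺)
open import Data.List.Relation.Binary.Sublist.Propositional using (_⊆_; []; _∷_; _∷ʳ_; ⊆-refl)
open import Data.List.Relation.Binary.Sublist.Propositional.Properties using (All-resp-⊆)
open import Function using (_∘_; id)
open import Relation.Binary.Bundles using (Setoid)
open import Relation.Binary.Definitions using (DecidableEquality)
open import Relation.Binary.PropositionalEquality as ≡ using (_≡_; _≢_; refl)
import Relation.Binary.Reasoning.Setoid as SetoidReasoning
open import Relation.Nullary using (Dec; yes; no; ¬_)
open import Relation.Nullary.Decidable using (_×-dec_)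
open import Relation.Unary using (Decidable)

_≟ₑ_ : DecidableEquality Edge
_≟ₑ_ = ≡-dec ℕ._≟_ ℕ._≟_

_≺_ : Edge → Edge → Set
e ≺ e′ = proj₁ e < proj₁ e′ × proj₂ e ≢ proj₂ e′

_#_ : Edge → Edge → Set
e # e′ = proj₁ e ≢ proj₁ e′ × proj₂ e ≢ proj₂ e′

Sorted : Simplex → Set
Sorted = AllPairs (λ e e′ → proj₁ e < proj₁ e′)

matching⇒sorted : ∀ {σ} → AllPairs _≺_ σ → Sorted σ
matching⇒sorted = AllPairs.map proj₁

AllPairs-resp-⊆ : ∀ {Q : Edge → Edge → Set} {ρ σ} → ρ ⊆ σ → AllPairs Q σ → AllPairs Q ρ
AllPairs-resp-⊆ []           []       = []
AllPairs-resp-⊆ (refl ∷ ρ⊆σ) (q ∷ qs) = All-resp-⊆ ρ⊆σ q ∷ AllPairs-resp-⊆ ρ⊆σ qs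
AllPairs-resp-⊆ (_ ∷ʳ ρ⊆σ)   (_ ∷ qs) = AllPairs-resp-⊆ ρ⊆σ qs

insert : Edge → Simplex → Simplex
insert e [] = e ∷ []
insert e (x ∷ τ) with proj₁ e <? proj₁ x
... | yes _ = e ∷ x ∷ τ
... | no  _ = x ∷ insert e τ

remove : Edge → Simplex → Simplex
remove e [] = []
remove e (x ∷ σ) with x ≟ₑ e
... | yes _ = σ
... | no  _ = x ∷ remove e σ

length-insert : ∀ e τ → length (insert e τ) ≡ suc (length τ)
length-insert e [] = refl
length-insert e (x ∷ τ) with proj₁ e <? proj₁ x
... | yes _ = refl
... | no  _ = ≡.cong suc (length-insert e τ)

insert⁺ : ∀ {P : Edge → Set} e τ → P e → All P τ → All P (insert e τ)
insert⁺ e [] pe [] = pe ∷ []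
insert⁺ e (x ∷ τ) pe (px ∷ pτ) with proj₁ e <? proj₁ x
... | yes _ = pe ∷ px ∷ pτ
... | no  _ = px ∷ insert⁺ e τ pe pτ

insert-matching : ∀ e τ → All (e #_) τ → AllPairs _≺_ τ → AllPairs _≺_ (insert e τ)
insert-matching e [] [] [] = [] ∷ []
insert-matching e (x ∷ τ) ((e≢x , e≢′x) ∷ e#τ) (x≺τ ∷ τ-match) with proj₁ e <? proj₁ x
... | yes e<x =
  ((e<x , e≢′x) ∷ All.zipWith (λ (x≺y , _ , e≢′y) → <-trans e<x (proj₁ x≺y) , e≢′y) (x≺τ , e#τ))
  ∷ x≺τ ∷ τ-match
... | no  e≮x = insert⁺ e τ (x<e , e≢′x ∘ ≡.sym) x≺τ ∷ insert-matching e τ e#τ τ-match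
  where
  x<e : proj₁ x < proj₁ e
  x<e = ≤∧≢⇒< (≮⇒≥ e≮x) (λ x≡e → e≢x (≡.sym x≡e))

remove-⊆ : ∀ e σ → remove e σ ⊆ σ
remove-⊆ e [] = []
remove-⊆ e (x ∷ σ) with x ≟ₑ e
... | yes _ = x ∷ʳ ⊆-refl
... | no  _ = refl ∷ remove-⊆ e σ

length-remove : ∀ {e σ} → e ∈ σ → suc (length (remove e σ)) ≡ length σ
length-remove {e} {x ∷ σ} e∈σ with x ≟ₑ e
... | yes _ = refl
length-remove (here e≡x)  | no x≢e = ⊥-elim (x≢e (≡.sym e≡x))
length-remove (there e∈σ) | no _   = ≡.cong suc (length-remove e∈σ)

remove-disjoint : ∀ {e σ} → AllPairs _≺_ σ → e ∈ σ → All (_# e) (remove e σ)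
remove-disjoint {e} {x ∷ σ} (x≺σ ∷ σ-match) e∈σ with x ≟ₑ e
... | yes refl = All.map (λ (x<y , x≢′y) → (<⇒≢ x<y ∘ ≡.sym) , (x≢′y ∘ ≡.sym)) x≺σ
remove-disjoint (_ ∷ _) (here e≡x) | no x≢e = ⊥-elim (x≢e (≡.sym e≡x))
remove-disjoint {e} {x ∷ σ} (x≺σ ∷ σ-match) (there e∈σ) | no _ = x#e ∷ remove-disjoint σ-match e∈σ
  where
  x#e : x # e
  x#e = let (x<e , x≢′e) = All.lookup x≺σ e∈σ in <⇒≢ x<e , x≢′e

matching-right-unique : ∀ {σ a b} → AllPairs _≺_ σ → a ∈ σ → b ∈ σ → proj₂ a ≡ proj₂ b → a ≡ b
matching-right-unique _         (here refl)  (here refl)  _    = refl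
matching-right-unique (x≺σ ∷ _) (here refl)  (there b∈σ) a≡′b = ⊥-elim (proj₂ (All.lookup x≺σ b∈σ) a≡′b)
matching-right-unique (x≺σ ∷ _) (there a∈σ) (here refl)  a≡′b =
  ⊥-elim (proj₂ (All.lookup x≺σ a∈σ) (≡.sym a≡′b))
matching-right-unique (_ ∷ σ-match) (there a∈σ) (there b∈σ) a≡′b =
  matching-right-unique σ-match a∈σ b∈σ a≡′b

3+toℕ≤ : ∀ m (i : Fin (m ∸ 2)) → 3 ℕ.+ toℕ i ≤ m
3+toℕ≤ (suc (suc m)) i = s≤s (s≤s (toℕ<n i))

module MatchingComplexes (m n : ℕ) (1≤n : 1 ≤ n) where

  k : ℕ
  k = m ∸ 2

  Forbidden : Edge → Set
  Forbidden e = [ 3 , m ] (proj₁ e) × proj₂ e ≡ 1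

  forbidden? : Decidable Forbidden
  forbidden? (s , t) = ((3 ≤? s) ×-dec (s ≤? m)) ×-dec (t ℕ.≟ 1)

  forbidden : Fin k → Edge
  forbidden i = 3 ℕ.+ toℕ i , 1

  Link : Fin k → Complex
  Link i = M (⟦ m ⟧ ∖｛ 3 ℕ.+ toℕ i ｝) [ 2 , n ]

  forbidden-isForbidden : ∀ i → Forbidden (forbidden i)
  forbidden-isForbidden i = (s≤s (s≤s (s≤s z≤n)) , 3+toℕ≤ m i) , refl

  forbidden-injective : ∀ {i j} → forbidden i ≡ forbidden j → i ≡ j
  forbidden-injective eq = toℕ-injective (+-cancelˡ-≡ 3 _ _ (≡.cong proj₁ eq))

  forbidden-surjective : ∀ {e} → Forbidden e → ∃ λ i → forbidden i ≡ e
  forbidden-surjective {suc (suc (suc t)) , _} ((s≤s (s≤s (s≤s z≤n)) , 3+t≤m) , refl) =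
    fromℕ< (∸-monoˡ-≤ 2 3+t≤m) , ≡.cong (λ t → 3 ℕ.+ t , 1) (toℕ-fromℕ< _)

  Γ⇒forbidden∉ : ∀ {σ} i → Γ m n σ → forbidden i ∉ σ
  Γ⇒forbidden∉ i (_ , allowed) fi∈σ = All.lookup allowed fi∈σ (forbidden-isForbidden i)

  Link⇒Γ : ∀ {σ} i → Link i σ → Γ m n σ
  Link⇒Γ i (match , inLink) =
    (match , All.map (λ ((inₘ , _) , (2≤t , t≤n)) → inₘ , (≤-trans (s≤s z≤n) 2≤t , t≤n)) inLink) ,
    All.map (λ (_ , (2≤t , _)) (_ , t≡1) → n≮n 1 (≡.subst (2 ≤_) t≡1 2≤t)) inLink

  insert-forbidden : ∀ {τ} i → Link i τ → Mmn m n (insert (forbidden i) τ)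
  insert-forbidden {τ} i (match , inLink) =
    insert-matching (forbidden i) τ (All.map disjoint inLink) match ,
    insert⁺ (forbidden i) τ ((s≤s z≤n , 3+toℕ≤ m i) , (s≤s z≤n , 1≤n))
      (All.map (λ ((inₘ , _) , (2≤t , t≤n)) → inₘ , (≤-trans (s≤s z≤n) 2≤t , t≤n)) inLink)
    where
    disjoint : ∀ {x} → (⟦ m ⟧ ∖｛ 3 ℕ.+ toℕ i ｝) (proj₁ x) × [ 2 , n ] (proj₂ x) → forbidden i # x
    disjoint ((_ , x≢s) , (2≤t , _)) = x≢s ∘ ≡.sym , λ 1≡t → n≮n 1 (≡.subst (2 ≤_) (≡.sym 1≡t) 2≤t)

  remove-forbidden : ∀ {σ} i → Mmn m n σ → forbidden i ∈ σ → Link i (remove (forbidden i) σ)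
  remove-forbidden {σ} i (match , inM) fi∈σ =
    AllPairs-resp-⊆ (remove-⊆ (forbidden i) σ) match ,
    All.zipWith (λ ((inₘ , 1≤t , t≤n) , (x≢s , t≢1)) → (inₘ , x≢s) , ≤∧≢⇒< 1≤t (t≢1 ∘ ≡.sym) , t≤n)
      (All-resp-⊆ (remove-⊆ (forbidden i) σ) inM , remove-disjoint match fi∈σ)

+-suc : ∀ a → + suc a ≡ + a ℤ.+ 1ℤ
+-suc a = ≡.trans (≡.cong +_ (ℕ.+-comm 1 a)) (ℤ.pos-+ a 1)

+1-injective : ∀ {i j} → i ℤ.+ 1ℤ ≡ j ℤ.+ 1ℤ → i ≡ j
+1-injective {i} {j} = ∙-cancelʳ 1ℤ i j

[i-1]+1≡i : ∀ i → (i ℤ.- 1ℤ) ℤ.+ 1ℤ ≡ i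
[i-1]+1≡i i = begin
  (i ℤ.- 1ℤ) ℤ.+ 1ℤ      ≡⟨ ℤ.+-assoc i (ℤ.- 1ℤ) 1ℤ ⟩
  i ℤ.+ (ℤ.- 1ℤ ℤ.+ 1ℤ)  ≡⟨ ≡.cong (λ j → i ℤ.+ j) (ℤ.+-inverseˡ 1ℤ) ⟩
  i ℤ.+ ℤ.0ℤ             ≡⟨ ℤ.+-identityʳ i ⟩
  i                      ∎
  where open ≡.≡-Reasoning

module ChainAlgebra {c ℓ : Level} (R : Ring c ℓ) where
  open Ring R renaming (refl to ≈-refl; sym to ≈-sym; trans to ≈-trans)
  open RingProperties R using (-0#≈0#; -‿involutive; -‿+-comm; -‿distribˡ-*; -‿distribʳ-*)
  open CommutativeSemigroupProperties +-commutativeSemigroup using (interchange)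

  infix 4 _≋_
  record _≋_ (x y : Chain R) : Set ℓ where
    constructor coeffwise
    field coeff-≈ : ∀ τ → coeff R x τ ≈ coeff R y τ
  open _≋_ public

  ≋-refl : ∀ {x} → x ≋ x
  ≋-refl = coeffwise λ _ → ≈-refl

  ≋-sym : ∀ {x y} → x ≋ y → y ≋ x
  ≋-sym x≋y = coeffwise λ τ → ≈-sym (coeff-≈ x≋y τ)

  ≋-trans : ∀ {x y z} → x ≋ y → y ≋ z → x ≋ z
  ≋-trans x≋y y≋z = coeffwise λ τ → ≈-trans (coeff-≈ x≋y τ) (coeff-≈ y≋z τ)

  ≡⇒≋ : ∀ {x y} → x ≡ y → x ≋ y
  ≡⇒≋ refl = ≋-refl

  ≋-setoid : Setoid c ℓ
  ≋-setoid = record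
    { Carrier = Chain R
    ; _≈_ = _≋_
    ; isEquivalence = record { refl = ≋-refl ; sym = ≋-sym ; trans = ≋-trans }
    }

  neg : Chain R → Chain R
  neg = map (λ (r , σ) → (- r , σ))

  single : Carrier → Simplex → Chain R
  single r σ = (r , σ) ∷ []

  coeff-++ : ∀ xs ys τ → coeff R (xs ++ ys) τ ≈ coeff R xs τ + coeff R ys τ
  coeff-++ [] ys τ = ≈-sym (+-identityˡ _)
  coeff-++ ((r , σ) ∷ xs) ys τ with σ ≟ₛ τ
  ... | yes _ = ≈-trans (+-congˡ (coeff-++ xs ys τ)) (≈-sym (+-assoc _ _ _))
  ... | no  _ = coeff-++ xs ys τ

  coeff-scale : ∀ r xs τ → coeff R (scale R r xs) τ ≈ r * coeff R xs τ
  coeff-scale r [] τ = ≈-sym (zeroʳ r)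
  coeff-scale r ((s , σ) ∷ xs) τ with σ ≟ₛ τ
  ... | yes _ = ≈-trans (+-congˡ (coeff-scale r xs τ)) (≈-sym (distribˡ r s _))
  ... | no  _ = coeff-scale r xs τ

  coeff-neg : ∀ xs τ → coeff R (neg xs) τ ≈ - coeff R xs τ
  coeff-neg [] τ = ≈-sym -0#≈0#
  coeff-neg ((s , σ) ∷ xs) τ with σ ≟ₛ τ
  ... | yes _ = ≈-trans (+-congˡ (coeff-neg xs τ)) (-‿+-comm _ _)
  ... | no  _ = coeff-neg xs τ

  coeff-single-≢ : ∀ r {σ τ} → σ ≢ τ → coeff R (single r σ) τ ≈ 0#
  coeff-single-≢ r {σ} {τ} σ≢τ with σ ≟ₛ τ
  ... | yes σ≡τ = ⊥-elim (σ≢τ σ≡τ)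
  ... | no  _   = ≈-refl

  coeff-single-≡ : ∀ r {σ τ} → σ ≡ τ → coeff R (single r σ) τ ≈ r
  coeff-single-≡ r {σ} {τ} σ≡τ with σ ≟ₛ τ
  ... | yes _   = +-identityʳ r
  ... | no  σ≢τ = ⊥-elim (σ≢τ σ≡τ)

  coeff-∷ : ∀ r σ xs τ → coeff R ((r , σ) ∷ xs) τ ≈ coeff R (single r σ) τ + coeff R xs τ
  coeff-∷ r σ xs τ with σ ≟ₛ τ
  ... | yes _ = +-congʳ (≈-sym (+-identityʳ r))
  ... | no  _ = ≈-sym (+-identityˡ _)

  ∷-cong : ∀ {r s σ xs ys} → r ≈ s → xs ≋ ys → (r , σ) ∷ xs ≋ (s , σ) ∷ ys
  ∷-cong {r} {s} {σ} {xs} {ys} r≈s xs≋ys = coeffwise λ τ → begin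
    coeff R ((r , σ) ∷ xs) τ                   ≈⟨ coeff-∷ r σ xs τ ⟩
    coeff R (single r σ) τ + coeff R xs τ      ≈⟨ +-cong (head τ) (coeff-≈ xs≋ys τ) ⟩
    coeff R (single s σ) τ + coeff R ys τ      ≈⟨ coeff-∷ s σ ys τ ⟨
    coeff R ((s , σ) ∷ ys) τ                   ∎
    where
    open SetoidReasoning setoid
    head : ∀ τ → coeff R (single r σ) τ ≈ coeff R (single s σ) τ
    head τ with σ ≟ₛ τ
    ... | yes _ = +-congʳ r≈s
    ... | no  _ = ≈-refl

  map-≋ : ∀ (f g : Carrier × Simplex → Carrier × Simplex) xs →
          (∀ p → proj₁ (f p) ≈ proj₁ (g p)) → (∀ p → proj₂ (f p) ≡ proj₂ (g p)) → map f xs ≋ map g xs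
  map-≋ f g [] _ _ = ≋-refl
  map-≋ f g (p ∷ xs) f≈g f≡g with f p | g p | f≈g p | f≡g p
  ... | _ , σ | _ , .σ | r≈s | refl = ∷-cong r≈s (map-≋ f g xs f≈g f≡g)

  ++-cong : ∀ {a b c d} → a ≋ b → c ≋ d → a ++ c ≋ b ++ d
  ++-cong {a} {b} {c} {d} a≋b c≋d = coeffwise λ τ →
    ≈-trans (coeff-++ a c τ) (≈-trans (+-cong (coeff-≈ a≋b τ) (coeff-≈ c≋d τ)) (≈-sym (coeff-++ b d τ)))

  ++-congˡ : ∀ a {b d} → b ≋ d → a ++ b ≋ a ++ d
  ++-congˡ a = ++-cong (≋-refl {a})

  ++-comm : ∀ a b → a ++ b ≋ b ++ a
  ++-comm a b = coeffwise λ τ → ≈-trans (coeff-++ a b τ) (≈-trans (+-comm _ _) (≈-sym (coeff-++ b a τ)))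

  ++-assoc : ∀ a b d → (a ++ b) ++ d ≋ a ++ (b ++ d)
  ++-assoc a b d = ≡⇒≋ (List.++-assoc a b d)

  ++-identityʳ : ∀ a → a ++ [] ≋ a
  ++-identityʳ a = ≡⇒≋ (List.++-identityʳ a)

  ++-interchange : ∀ a b c d → (a ++ b) ++ (c ++ d) ≋ (a ++ c) ++ (b ++ d)
  ++-interchange a b c d = coeffwise λ τ → begin
    coeff R ((a ++ b) ++ (c ++ d)) τ
      ≈⟨ ≈-trans (coeff-++ (a ++ b) (c ++ d) τ) (+-cong (coeff-++ a b τ) (coeff-++ c d τ)) ⟩
    (coeff R a τ + coeff R b τ) + (coeff R c τ + coeff R d τ)
      ≈⟨ interchange _ _ _ _ ⟩
    (coeff R a τ + coeff R c τ) + (coeff R b τ + coeff R d τ)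
      ≈⟨ ≈-trans (coeff-++ (a ++ c) (b ++ d) τ) (+-cong (coeff-++ a c τ) (coeff-++ b d τ)) ⟨
    coeff R ((a ++ c) ++ (b ++ d)) τ ∎
    where open SetoidReasoning setoid

  ++-left-comm : ∀ a b d → a ++ (b ++ d) ≋ b ++ (a ++ d)
  ++-left-comm a b d = ≋-trans (≋-sym (++-assoc a b d)) (≋-trans (++-cong (++-comm a b) ≋-refl) (++-assoc b a d))

  neg-cong : ∀ {a b} → a ≋ b → neg a ≋ neg b
  neg-cong {a} {b} a≋b = coeffwise λ τ →
    ≈-trans (coeff-neg a τ) (≈-trans (-‿cong (coeff-≈ a≋b τ)) (≈-sym (coeff-neg b τ)))

  neg-++ : ∀ a b → neg (a ++ b) ≋ neg a ++ neg b
  neg-++ a b = ≡⇒≋ (List.map-++ _ a b)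

  neg-involutive : ∀ a → neg (neg a) ≋ a
  neg-involutive a = coeffwise λ τ →
    ≈-trans (coeff-neg (neg a) τ) (≈-trans (-‿cong (coeff-neg a τ)) (-‿involutive _))

  ++-inverseʳ : ∀ a → a ++ neg a ≋ []
  ++-inverseʳ a = coeffwise λ τ →
    ≈-trans (coeff-++ a (neg a) τ) (≈-trans (+-congˡ (coeff-neg a τ)) (-‿inverseʳ _))

  neg-≋[] : ∀ {a} → a ≋ [] → neg a ≋ []
  neg-≋[] {a} a≋[] = coeffwise λ τ → ≈-trans (coeff-neg a τ) (≈-trans (-‿cong (coeff-≈ a≋[] τ)) -0#≈0#)

  neg-of-summand : ∀ {y g s} → y ≋ g ++ s → neg g ≋ s ++ neg y
  neg-of-summand {y} {g} {s} y≋g+s = begin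
    neg g                        ≈⟨ ++-identityʳ (neg g) ⟨
    neg g ++ []                  ≈⟨ ++-congˡ (neg g) (++-inverseʳ s) ⟨
    neg g ++ (s ++ neg s)        ≈⟨ ++-left-comm (neg g) s (neg s) ⟩
    s ++ (neg g ++ neg s)        ≈⟨ ++-congˡ s (neg-++ g s) ⟨
    s ++ neg (g ++ s)            ≈⟨ ++-congˡ s (neg-cong y≋g+s) ⟨
    s ++ neg y                   ∎
    where open SetoidReasoning ≋-setoid

  ++-neg-cancelˡ : ∀ a b d → (a ++ b) ++ neg (a ++ d) ≋ b ++ neg d
  ++-neg-cancelˡ a b d = begin
    (a ++ b) ++ neg (a ++ d)       ≈⟨ ++-congˡ (a ++ b) (neg-++ a d) ⟩
    (a ++ b) ++ (neg a ++ neg d)   ≈⟨ ++-interchange a b (neg a) (neg d) ⟩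
    (a ++ neg a) ++ (b ++ neg d)   ≈⟨ ++-cong (++-inverseʳ a) ≋-refl ⟩
    b ++ neg d                     ∎
    where open SetoidReasoning ≋-setoid

  scale-cong : ∀ r {a b} → a ≋ b → scale R r a ≋ scale R r b
  scale-cong r {a} {b} a≋b = coeffwise λ τ →
    ≈-trans (coeff-scale r a τ) (≈-trans (*-congˡ (coeff-≈ a≋b τ)) (≈-sym (coeff-scale r b τ)))

  scale-++ : ∀ r a b → scale R r (a ++ b) ≡ scale R r a ++ scale R r b
  scale-++ r a b = List.map-++ _ a b

  scale-* : ∀ r s a → scale R (r * s) a ≋ scale R r (scale R s a)
  scale-* r s a = coeffwise λ τ → begin
    coeff R (scale R (r * s) a) τ       ≈⟨ coeff-scale (r * s) a τ ⟩
    (r * s) * coeff R a τ               ≈⟨ *-assoc r s _ ⟩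
    r * (s * coeff R a τ)               ≈⟨ *-congˡ (coeff-scale s a τ) ⟨
    r * coeff R (scale R s a) τ         ≈⟨ coeff-scale r (scale R s a) τ ⟨
    coeff R (scale R r (scale R s a)) τ ∎
    where open SetoidReasoning setoid

  scale-1 : ∀ a → scale R 1# a ≋ a
  scale-1 a = ≋-trans (map-≋ _ _ a (λ _ → *-identityˡ _) (λ _ → refl)) (≡⇒≋ (List.map-id a))

  scale-neg : ∀ r a → scale R (- r) a ≋ neg (scale R r a)
  scale-neg r a = coeffwise λ τ → begin
    coeff R (scale R (- r) a) τ      ≈⟨ coeff-scale (- r) a τ ⟩
    - r * coeff R a τ                ≈⟨ -‿distribˡ-* r _ ⟨
    - (r * coeff R a τ)              ≈⟨ -‿cong (coeff-scale r a τ) ⟨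
    - coeff R (scale R r a) τ        ≈⟨ coeff-neg (scale R r a) τ ⟨
    coeff R (neg (scale R r a)) τ    ∎
    where open SetoidReasoning setoid

  scale-neg-chain : ∀ r a → scale R r (neg a) ≋ neg (scale R r a)
  scale-neg-chain r a = coeffwise λ τ → begin
    coeff R (scale R r (neg a)) τ    ≈⟨ coeff-scale r (neg a) τ ⟩
    r * coeff R (neg a) τ            ≈⟨ *-congˡ (coeff-neg a τ) ⟩
    r * - coeff R a τ                ≈⟨ -‿distribʳ-* r _ ⟨
    - (r * coeff R a τ)              ≈⟨ -‿cong (coeff-scale r a τ) ⟨
    - coeff R (scale R r a) τ        ≈⟨ coeff-neg (scale R r a) τ ⟨
    coeff R (neg (scale R r a)) τ    ∎
    where open SetoidReasoning setoid

  neg-support : ∀ {Q : Simplex → Set} xs → All (λ (_ , σ) → Q σ) xs → All (λ (_ , σ) → Q σ) (neg xs)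
  neg-support xs qs = All.map⁺ (All.map id qs)

  Σᶜ : ∀ k → (Fin k → Chain R) → Chain R
  Σᶜ zero    f = []
  Σᶜ (suc k) f = f fzero ++ Σᶜ k (f ∘ fsuc)

  Σᶜ-cong : ∀ k {f g : Fin k → Chain R} → (∀ i → f i ≋ g i) → Σᶜ k f ≋ Σᶜ k g
  Σᶜ-cong zero    f≋g = ≋-refl
  Σᶜ-cong (suc k) f≋g = ++-cong (f≋g fzero) (Σᶜ-cong k (f≋g ∘ fsuc))

  Σᶜ-vanishing : ∀ k {f : Fin k → Chain R} → (∀ i → f i ≋ []) → Σᶜ k f ≋ []
  Σᶜ-vanishing zero    f≋[] = ≋-refl
  Σᶜ-vanishing (suc k) f≋[] = ++-cong (f≋[] fzero) (Σᶜ-vanishing k (f≋[] ∘ fsuc))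

  Σᶜ-δ : ∀ k {f : Fin k → Chain R} i → (∀ j → j ≢ i → f j ≋ []) → Σᶜ k f ≋ f i
  Σᶜ-δ (suc k) fzero    off =
    ≋-trans (++-cong ≋-refl (Σᶜ-vanishing k (λ j → off (fsuc j) (λ ())))) (++-identityʳ _)
  Σᶜ-δ (suc k) (fsuc i) off =
    ++-cong (off fzero (λ ())) (Σᶜ-δ k i (λ j j≢i → off (fsuc j) (j≢i ∘ suc-injective)))

  Σᶜ-++ : ∀ k (f g : Fin k → Chain R) → Σᶜ k (λ i → f i ++ g i) ≋ Σᶜ k f ++ Σᶜ k g
  Σᶜ-++ zero    f g = ≋-refl
  Σᶜ-++ (suc k) f g = ≋-trans (++-cong ≋-refl (Σᶜ-++ k (f ∘ fsuc) (g ∘ fsuc)))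
                              (++-interchange (f fzero) (g fzero) _ _)

  Σᶜ-neg : ∀ k (f : Fin k → Chain R) → Σᶜ k (neg ∘ f) ≋ neg (Σᶜ k f)
  Σᶜ-neg zero    f = ≋-refl
  Σᶜ-neg (suc k) f = ≋-trans (++-cong ≋-refl (Σᶜ-neg k (f ∘ fsuc))) (≋-sym (neg-++ (f fzero) _))

  Σᶜ-scale : ∀ r k (f : Fin k → Chain R) → Σᶜ k (scale R r ∘ f) ≋ scale R r (Σᶜ k f)
  Σᶜ-scale r zero    f = ≋-refl
  Σᶜ-scale r (suc k) f = ≋-trans (++-cong ≋-refl (Σᶜ-scale r k (f ∘ fsuc)))
                                 (≡⇒≋ (≡.sym (scale-++ r (f fzero) _)))

  Σᶜ-support : ∀ {Q : Simplex → Set} k (f : Fin k → Chain R) →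
               (∀ i → All (λ (_ , σ) → Q σ) (f i)) → All (λ (_ , σ) → Q σ) (Σᶜ k f)
  Σᶜ-support zero    f _  = []
  Σᶜ-support (suc k) f qs = All.++⁺ (qs fzero) (Σᶜ-support k (f ∘ fsuc) (qs ∘ fsuc))

module LinearExtension {c ℓ : Level} (R : Ring c ℓ) where
  open Ring R renaming (refl to ≈-refl; sym to ≈-sym; trans to ≈-trans)
  open CommutativeSemigroupProperties +-commutativeSemigroup using (interchange)
  open ChainAlgebra R

  bind : (Simplex → Chain R) → Chain R → Chain R
  bind φ [] = []
  bind φ ((r , σ) ∷ xs) = scale R r (φ σ) ++ bind φ xs

  ∂≡bind-faces : ∀ xs → ∂ R xs ≡ bind (faces R) xs
  ∂≡bind-faces [] = refl
  ∂≡bind-faces ((r , σ) ∷ xs) = ≡.cong (scale R r (faces R σ) ++_) (∂≡bind-faces xs)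

  bind-++ : ∀ φ xs ys → bind φ (xs ++ ys) ≋ bind φ xs ++ bind φ ys
  bind-++ φ xs ys = ≡⇒≋ (go xs)
    where
    go : ∀ xs → bind φ (xs ++ ys) ≡ bind φ xs ++ bind φ ys
    go [] = refl
    go ((r , σ) ∷ xs) = ≡.trans (≡.cong (scale R r (φ σ) ++_) (go xs))
                                (≡.sym (List.++-assoc (scale R r (φ σ)) (bind φ xs) (bind φ ys)))

  private
    sumOver : List Simplex → (Simplex → Carrier) → Carrier
    sumOver [] f = 0#
    sumOver (σ ∷ L) f = f σ + sumOver L f

    sumOver-cong : ∀ L {f g} → (∀ σ → f σ ≈ g σ) → sumOver L f ≈ sumOver L g
    sumOver-cong [] f≈g = ≈-refl
    sumOver-cong (σ ∷ L) f≈g = +-cong (f≈g σ) (sumOver-cong L f≈g)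

    sumOver-+ : ∀ L f g → sumOver L (λ σ → f σ + g σ) ≈ sumOver L f + sumOver L g
    sumOver-+ [] f g = ≈-sym (+-identityˡ 0#)
    sumOver-+ (σ ∷ L) f g = ≈-trans (+-congˡ (sumOver-+ L f g)) (interchange _ _ _ _)

    sumOver-0 : ∀ L f → (∀ σ → f σ ≈ 0#) → sumOver L f ≈ 0#
    sumOver-0 [] f f≈0 = ≈-refl
    sumOver-0 (σ ∷ L) f f≈0 = ≈-trans (+-cong (f≈0 σ) (sumOver-0 L f f≈0)) (+-identityˡ 0#)

    sumOver-absent : ∀ L r σ₀ (f : Simplex → Carrier) → All (σ₀ ≢_) L →
                     sumOver L (λ σ → coeff R (single r σ₀) σ * f σ) ≈ 0#
    sumOver-absent [] r σ₀ f [] = ≈-refl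
    sumOver-absent (σ ∷ L) r σ₀ f (σ₀≢σ ∷ σ₀∉L) = ≈-trans
      (+-cong (≈-trans (*-congʳ (coeff-single-≢ r σ₀≢σ)) (zeroˡ _)) (sumOver-absent L r σ₀ f σ₀∉L))
      (+-identityˡ 0#)

    sumOver-single : ∀ L r σ₀ (f : Simplex → Carrier) → Unique L → σ₀ ∈ L →
                     sumOver L (λ σ → coeff R (single r σ₀) σ * f σ) ≈ r * f σ₀
    sumOver-single (σ ∷ L) r σ f (σ∉L ∷ _) (here refl) = ≈-trans
      (+-cong (*-congʳ (coeff-single-≡ r {σ} refl)) (sumOver-absent L r σ f σ∉L))
      (+-identityʳ _)
    sumOver-single (σ ∷ L) r σ₀ f (σ∉L ∷ L!) (there σ₀∈L) = ≈-trans
      (+-cong (≈-trans (*-congʳ (coeff-single-≢ r σ₀≢σ)) (zeroˡ _)) (sumOver-single L r σ₀ f L! σ₀∈L))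
      (+-identityˡ _)
      where
      σ₀≢σ : σ₀ ≢ σ
      σ₀≢σ σ₀≡σ = All.lookup σ∉L σ₀∈L (≡.sym σ₀≡σ)

    -- The coefficient of τ in bind φ xs is Σ_σ xs(σ) φ(σ)(τ), computed over any duplicate-free list
    -- of simplices containing the support of xs; this is why bind respects _≋_.
    coeff-bind : ∀ φ L → Unique L → ∀ xs → All (λ (_ , σ) → σ ∈ L) xs → ∀ τ →
                 coeff R (bind φ xs) τ ≈ sumOver L (λ σ → coeff R xs σ * coeff R (φ σ) τ)
    coeff-bind φ L L! [] [] τ = ≈-sym (sumOver-0 L _ (λ σ → zeroˡ _))
    coeff-bind φ L L! ((r , σ₀) ∷ xs) (σ₀∈L ∷ xs⊆L) τ = begin
      coeff R (scale R r (φ σ₀) ++ bind φ xs) τ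
        ≈⟨ coeff-++ (scale R r (φ σ₀)) _ τ ⟩
      coeff R (scale R r (φ σ₀)) τ + coeff R (bind φ xs) τ
        ≈⟨ +-cong (coeff-scale r (φ σ₀) τ) (coeff-bind φ L L! xs xs⊆L τ) ⟩
      r * coeff R (φ σ₀) τ + sumOver L (λ σ → coeff R xs σ * coeff R (φ σ) τ)
        ≈⟨ +-congʳ (sumOver-single L r σ₀ (λ σ → coeff R (φ σ) τ) L! σ₀∈L) ⟨
      sumOver L (λ σ → coeff R (single r σ₀) σ * coeff R (φ σ) τ)
        + sumOver L (λ σ → coeff R xs σ * coeff R (φ σ) τ)
        ≈⟨ sumOver-+ L _ _ ⟨
      sumOver L (λ σ → coeff R (single r σ₀) σ * coeff R (φ σ) τ + coeff R xs σ * coeff R (φ σ) τ)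
        ≈⟨ sumOver-cong L (λ σ → ≈-trans (≈-sym (distribʳ _ _ _))
                                         (*-congʳ (≈-sym (coeff-∷ r σ₀ xs σ)))) ⟩
      sumOver L (λ σ → coeff R ((r , σ₀) ∷ xs) σ * coeff R (φ σ) τ) ∎
      where open SetoidReasoning setoid

  bind-cong : ∀ φ {xs ys} → xs ≋ ys → bind φ xs ≋ bind φ ys
  bind-cong φ {xs} {ys} xs≋ys = coeffwise λ τ → begin
    coeff R (bind φ xs) τ
      ≈⟨ coeff-bind φ L L! xs (support xs (∈-++⁺ˡ ∘ ∈-map⁺ proj₂)) τ ⟩
    sumOver L (λ σ → coeff R xs σ * coeff R (φ σ) τ)
      ≈⟨ sumOver-cong L (λ σ → *-congʳ (coeff-≈ xs≋ys σ)) ⟩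
    sumOver L (λ σ → coeff R ys σ * coeff R (φ σ) τ)
      ≈⟨ coeff-bind φ L L! ys (support ys (∈-++⁺ʳ (map proj₂ xs) ∘ ∈-map⁺ proj₂)) τ ⟨
    coeff R (bind φ ys) τ ∎
    where
    open SetoidReasoning setoid
    L : List Simplex
    L = deduplicate _≟ₛ_ (map proj₂ xs ++ map proj₂ ys)
    L! : Unique L
    L! = deduplicate-! _≟ₛ_ (map proj₂ xs ++ map proj₂ ys)
    support : ∀ zs → (∀ {p} → p ∈ zs → proj₂ p ∈ map proj₂ xs ++ map proj₂ ys) →
              All (λ (_ , σ) → σ ∈ L) zs
    support zs into = All.tabulate (λ p∈zs → ∈-deduplicate⁺ _≟ₛ_ (into p∈zs))

  bind-cong-on : ∀ {φ ψ} xs → All (λ (_ , σ) → φ σ ≋ ψ σ) xs → bind φ xs ≋ bind ψ xs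
  bind-cong-on [] [] = ≋-refl
  bind-cong-on ((r , σ) ∷ xs) (φσ≋ψσ ∷ φ≋ψ) = ++-cong (scale-cong r φσ≋ψσ) (bind-cong-on xs φ≋ψ)

  bind-cong-pointwise : ∀ {φ ψ} xs → (∀ σ → φ σ ≋ ψ σ) → bind φ xs ≋ bind ψ xs
  bind-cong-pointwise xs φ≋ψ = bind-cong-on xs (All.tabulate (λ {(_ , σ)} _ → φ≋ψ σ))

  bind-unit : ∀ φ σ → bind φ (single 1# σ) ≋ φ σ
  bind-unit φ σ = ≋-trans (++-identityʳ _) (scale-1 (φ σ))

  bind-[] : ∀ xs → bind (λ _ → []) xs ≋ []
  bind-[] [] = ≋-refl
  bind-[] (_ ∷ xs) = bind-[] xs

  bind-vanishing : ∀ {φ} xs → All (λ (_ , σ) → φ σ ≋ []) xs → bind φ xs ≋ []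
  bind-vanishing xs φ≋[] = ≋-trans (bind-cong-on xs φ≋[]) (bind-[] xs)

  bind-single : ∀ xs → bind (single 1#) xs ≋ xs
  bind-single [] = ≋-refl
  bind-single ((r , σ) ∷ xs) = ∷-cong (*-identityʳ r) (bind-single xs)

  bind-scale : ∀ φ r xs → bind φ (scale R r xs) ≋ scale R r (bind φ xs)
  bind-scale φ r [] = ≋-refl
  bind-scale φ r ((s , σ) ∷ xs) = ≋-trans (++-cong (scale-* r s (φ σ)) (bind-scale φ r xs))
                                          (≡⇒≋ (≡.sym (scale-++ r (scale R s (φ σ)) (bind φ xs))))

  bind-neg : ∀ φ xs → bind φ (neg xs) ≋ neg (bind φ xs)
  bind-neg φ [] = ≋-refl
  bind-neg φ ((r , σ) ∷ xs) = ≋-trans (++-cong (scale-neg r (φ σ)) (bind-neg φ xs))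
                                      (≋-sym (neg-++ (scale R r (φ σ)) (bind φ xs)))

  bind-bind : ∀ φ ψ xs → bind φ (bind ψ xs) ≋ bind (bind φ ∘ ψ) xs
  bind-bind φ ψ [] = ≋-refl
  bind-bind φ ψ ((r , σ) ∷ xs) = ≋-trans (bind-++ φ (scale R r (ψ σ)) (bind ψ xs))
                                         (++-cong (bind-scale φ r (ψ σ)) (bind-bind φ ψ xs))

  bind-++ᶠ : ∀ φ ψ xs → bind (λ σ → φ σ ++ ψ σ) xs ≋ bind φ xs ++ bind ψ xs
  bind-++ᶠ φ ψ [] = ≋-refl
  bind-++ᶠ φ ψ ((r , σ) ∷ xs) =
    ≋-trans (++-cong (≡⇒≋ (scale-++ r (φ σ) (ψ σ))) (bind-++ᶠ φ ψ xs))
            (++-interchange (scale R r (φ σ)) (scale R r (ψ σ)) (bind φ xs) (bind ψ xs))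

  bind-negᶠ : ∀ φ xs → bind (neg ∘ φ) xs ≋ neg (bind φ xs)
  bind-negᶠ φ [] = ≋-refl
  bind-negᶠ φ ((r , σ) ∷ xs) = ≋-trans (++-cong (scale-neg-chain r (φ σ)) (bind-negᶠ φ xs))
                                       (≋-sym (neg-++ (scale R r (φ σ)) (bind φ xs)))

  bind-support : ∀ {P Q : Simplex → Set} φ xs → All (λ (_ , σ) → P σ) xs →
                 (∀ σ → P σ → All (λ (_ , ρ) → Q ρ) (φ σ)) → All (λ (_ , ρ) → Q ρ) (bind φ xs)
  bind-support φ [] [] φ-support = []
  bind-support φ ((r , σ) ∷ xs) (pσ ∷ pxs) φ-support =
    All.++⁺ (All.map⁺ (All.map id (φ-support σ pσ))) (bind-support φ xs pxs φ-support)

  bind-Σᶜ : ∀ φ k (f : Fin k → Chain R) → bind φ (Σᶜ k f) ≋ Σᶜ k (bind φ ∘ f)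
  bind-Σᶜ φ zero    f = ≋-refl
  bind-Σᶜ φ (suc k) f = ≋-trans (bind-++ φ (f fzero) _) (++-cong ≋-refl (bind-Σᶜ φ k (f ∘ fsuc)))

  bind-Σᶜᶠ : ∀ k (φ : Fin k → Simplex → Chain R) xs →
             bind (λ σ → Σᶜ k (λ i → φ i σ)) xs ≋ Σᶜ k (λ i → bind (φ i) xs)
  bind-Σᶜᶠ zero    φ xs = bind-[] xs
  bind-Σᶜᶠ (suc k) φ xs = ≋-trans (bind-++ᶠ (φ fzero) (λ σ → Σᶜ k (λ i → φ (fsuc i) σ)) xs)
                                  (++-cong ≋-refl (bind-Σᶜᶠ k (φ ∘ fsuc) xs))

module Boundary {c ℓ : Level} (R : Ring c ℓ) where
  open Ring R renaming (refl to ≈-refl; sym to ≈-sym; trans to ≈-trans)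
  open RingProperties R using (-‿distribˡ-*; -‿distribʳ-*; -‿involutive)
  open ChainAlgebra R
  open LinearExtension R

  prepend : Edge → Chain R → Chain R
  prepend x = map (λ (r , σ) → (r , x ∷ σ))

  prepend⁻ : Edge → Chain R → Chain R
  prepend⁻ x = map (λ (r , σ) → (- r , x ∷ σ))

  prepend⁻≋neg-prepend : ∀ x d → prepend⁻ x d ≋ neg (prepend x d)
  prepend⁻≋neg-prepend x d = ≋-trans (map-≋ _ _ d (λ _ → ≈-refl) (λ _ → refl)) (≡⇒≋ (List.map-∘ d))

  prepend-neg : ∀ x d → prepend x (neg d) ≋ neg (prepend x d)
  prepend-neg x d = ≋-trans (≡⇒≋ (≡.sym (List.map-∘ d)))
                            (≋-trans (map-≋ _ _ d (λ _ → ≈-refl) (λ _ → refl)) (≡⇒≋ (List.map-∘ d)))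

  prepend-++ : ∀ x a b → prepend x (a ++ b) ≋ prepend x a ++ prepend x b
  prepend-++ x a b = ≡⇒≋ (List.map-++ _ a b)

  private
    coeff-prepend-∷ : ∀ x d τ → coeff R (prepend x d) (x ∷ τ) ≈ coeff R d τ
    coeff-prepend-∷ x [] τ = ≈-refl
    coeff-prepend-∷ x ((r , σ) ∷ d) τ = begin
      coeff R ((r , x ∷ σ) ∷ prepend x d) (x ∷ τ)
        ≈⟨ coeff-∷ r (x ∷ σ) (prepend x d) (x ∷ τ) ⟩
      coeff R (single r (x ∷ σ)) (x ∷ τ) + coeff R (prepend x d) (x ∷ τ)
        ≈⟨ +-cong (head (σ ≟ₛ τ)) (coeff-prepend-∷ x d τ) ⟩
      coeff R (single r σ) τ + coeff R d τ
        ≈⟨ coeff-∷ r σ d τ ⟨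
      coeff R ((r , σ) ∷ d) τ ∎
      where
      open SetoidReasoning setoid
      head : Dec (σ ≡ τ) → coeff R (single r (x ∷ σ)) (x ∷ τ) ≈ coeff R (single r σ) τ
      head (yes σ≡τ) =
        ≈-trans (coeff-single-≡ r {x ∷ σ} (≡.cong (x ∷_) σ≡τ)) (≈-sym (coeff-single-≡ r {σ} σ≡τ))
      head (no  σ≢τ) =
        ≈-trans (coeff-single-≢ r {x ∷ σ} (σ≢τ ∘ proj₂ ∘ List.∷-injective)) (≈-sym (coeff-single-≢ r σ≢τ))

    coeff-prepend-≢ : ∀ x d {τ} → (∀ ρ → τ ≢ x ∷ ρ) → coeff R (prepend x d) τ ≈ 0#
    coeff-prepend-≢ x [] _ = ≈-refl
    coeff-prepend-≢ x ((r , σ) ∷ d) {τ} τ≢x∷ = ≈-trans (coeff-∷ r (x ∷ σ) (prepend x d) τ)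
      (≈-trans (+-cong (coeff-single-≢ r (τ≢x∷ σ ∘ ≡.sym)) (coeff-prepend-≢ x d τ≢x∷)) (+-identityˡ 0#))

  prepend-cong : ∀ x {a b} → a ≋ b → prepend x a ≋ prepend x b
  prepend-cong x {a} {b} a≋b = coeffwise at
    where
    at : ∀ τ → coeff R (prepend x a) τ ≈ coeff R (prepend x b) τ
    at [] = ≈-trans (coeff-prepend-≢ x a λ _ ()) (≈-sym (coeff-prepend-≢ x b λ _ ()))
    at (y ∷ τ) with x ≟ₑ y
    ... | yes refl = ≈-trans (coeff-prepend-∷ x a τ) (≈-trans (coeff-≈ a≋b τ) (≈-sym (coeff-prepend-∷ x b τ)))
    ... | no  x≢y  = ≈-trans (coeff-prepend-≢ x a τ≢x∷) (≈-sym (coeff-prepend-≢ x b τ≢x∷))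
      where
      τ≢x∷ : ∀ ρ → y ∷ τ ≢ x ∷ ρ
      τ≢x∷ ρ eq = x≢y (≡.sym (proj₁ (List.∷-injective eq)))

  scale-prepend⁻ : ∀ r x a → scale R (- r) (prepend⁻ x a) ≋ prepend x (scale R r a)
  scale-prepend⁻ r x a =
    ≋-trans (≡⇒≋ (≡.sym (List.map-∘ a)))
            (≋-trans (map-≋ _ _ a (λ (s , _) → neg*neg r s) (λ _ → refl)) (≡⇒≋ (List.map-∘ a)))
    where
    neg*neg : ∀ r s → - r * - s ≈ r * s
    neg*neg r s = ≈-trans (≈-sym (-‿distribˡ-* r (- s)))
                          (≈-trans (-‿cong (≈-sym (-‿distribʳ-* r s))) (-‿involutive (r * s)))

  bind-prepend⁻ : ∀ φ α ψ x → (∀ ρ → φ (x ∷ ρ) ≡ α ρ ++ prepend⁻ x (ψ ρ)) →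
                  ∀ d → bind φ (prepend⁻ x d) ≋ neg (bind α d) ++ prepend x (bind ψ d)
  bind-prepend⁻ φ α ψ x φ-x∷ [] = ≋-refl
  bind-prepend⁻ φ α ψ x φ-x∷ ((r , ρ) ∷ d) = begin
    scale R (- r) (φ (x ∷ ρ)) ++ bind φ (prepend⁻ x d)
      ≡⟨ ≡.cong (λ φx∷ρ → scale R (- r) φx∷ρ ++ bind φ (prepend⁻ x d)) (φ-x∷ ρ) ⟩
    scale R (- r) (α ρ ++ prepend⁻ x (ψ ρ)) ++ bind φ (prepend⁻ x d)
      ≡⟨ ≡.cong (_++ bind φ (prepend⁻ x d)) (scale-++ (- r) (α ρ) (prepend⁻ x (ψ ρ))) ⟩
    (scale R (- r) (α ρ) ++ scale R (- r) (prepend⁻ x (ψ ρ))) ++ bind φ (prepend⁻ x d)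
      ≈⟨ ++-cong (++-cong (scale-neg r (α ρ)) (scale-prepend⁻ r x (ψ ρ))) (bind-prepend⁻ φ α ψ x φ-x∷ d) ⟩
    (neg (scale R r (α ρ)) ++ prepend x (scale R r (ψ ρ))) ++ (neg (bind α d) ++ prepend x (bind ψ d))
      ≈⟨ ++-interchange (neg (scale R r (α ρ))) (prepend x (scale R r (ψ ρ)))
                        (neg (bind α d)) (prepend x (bind ψ d)) ⟩
    (neg (scale R r (α ρ)) ++ neg (bind α d)) ++ (prepend x (scale R r (ψ ρ)) ++ prepend x (bind ψ d))
      ≈⟨ ++-cong (neg-++ (scale R r (α ρ)) (bind α d)) (prepend-++ x (scale R r (ψ ρ)) (bind ψ d)) ⟨
    neg (scale R r (α ρ) ++ bind α d) ++ prepend x (scale R r (ψ ρ) ++ bind ψ d) ∎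
    where open SetoidReasoning ≋-setoid

  bind-prepend⁻-commute : ∀ φ ψ x → (∀ ρ → φ (x ∷ ρ) ≡ prepend⁻ x (ψ ρ)) →
                          ∀ d → bind φ (prepend⁻ x d) ≋ prepend x (bind ψ d)
  bind-prepend⁻-commute φ ψ x φ-x∷ d =
    ≋-trans (bind-prepend⁻ φ (λ _ → []) ψ x φ-x∷ d) (++-cong (neg-≋[] (bind-[] d)) ≋-refl)

  bind-prepend : ∀ x d → bind (λ ρ → single 1# (x ∷ ρ)) d ≋ prepend x d
  bind-prepend x [] = ≋-refl
  bind-prepend x ((r , σ) ∷ d) = ∷-cong (*-identityʳ r) (bind-prepend x d)

  ∂-cong : ∀ {xs ys} → xs ≋ ys → ∂ R xs ≋ ∂ R ys
  ∂-cong {xs} {ys} xs≋ys rewrite ∂≡bind-faces xs | ∂≡bind-faces ys = bind-cong (faces R) xs≋ys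

  ∂-++ : ∀ a b → ∂ R (a ++ b) ≋ ∂ R a ++ ∂ R b
  ∂-++ a b rewrite ∂≡bind-faces (a ++ b) | ∂≡bind-faces a | ∂≡bind-faces b = bind-++ (faces R) a b

  ∂-neg : ∀ a → ∂ R (neg a) ≋ neg (∂ R a)
  ∂-neg a rewrite ∂≡bind-faces (neg a) | ∂≡bind-faces a = bind-neg (faces R) a

  ∂-Σᶜ : ∀ k (f : Fin k → Chain R) → ∂ R (Σᶜ k f) ≋ Σᶜ k (∂ R ∘ f)
  ∂-Σᶜ k f rewrite ∂≡bind-faces (Σᶜ k f) =
    ≋-trans (bind-Σᶜ (faces R) k f) (Σᶜ-cong k (λ i → ≡⇒≋ (≡.sym (∂≡bind-faces (f i)))))

  ∂-single : ∀ σ → ∂ R (single 1# σ) ≋ faces R σ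
  ∂-single = bind-unit (faces R)

  ∂-bind : ∀ ψ d → ∂ R (bind ψ d) ≋ bind (∂ R ∘ ψ) d
  ∂-bind ψ d rewrite ∂≡bind-faces (bind ψ d) =
    ≋-trans (bind-bind (faces R) ψ d) (bind-cong-pointwise d (λ σ → ≡⇒≋ (≡.sym (∂≡bind-faces (ψ σ)))))

  bind-∂ : ∀ φ d → bind φ (∂ R d) ≋ bind (bind φ ∘ faces R) d
  bind-∂ φ d rewrite ∂≡bind-faces d = bind-bind φ (faces R) d

  faces-⊆ : ∀ σ → All (λ (_ , ρ) → ρ ⊆ σ) (faces R σ)
  faces-⊆ [] = []
  faces-⊆ (x ∷ σ) = (x ∷ʳ ⊆-refl) ∷ All.map⁺ (All.map (refl ∷_) (faces-⊆ σ))

  ∂-prepend⁻ : ∀ x d → ∂ R (prepend⁻ x d) ≋ neg d ++ prepend x (∂ R d)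
  ∂-prepend⁻ x d rewrite ∂≡bind-faces (prepend⁻ x d) | ∂≡bind-faces d =
    ≋-trans (bind-prepend⁻ (faces R) (single 1#) (faces R) x (λ _ → refl) d)
            (++-cong (neg-cong (bind-single d)) ≋-refl)

module EdgeAttachment {c ℓ : Level} (R : Ring c ℓ) where
  open Ring R renaming (refl to ≈-refl; sym to ≈-sym; trans to ≈-trans)
  open ChainAlgebra R
  open LinearExtension R
  open Boundary R

  -- attach e τ is (−1)^j (τ with e inserted) and detach e σ is (−1)^j (σ with e removed), where j is
  -- the number of edges before e; these signs are those of the join with e under the orientation of faces.
  attach : Edge → Simplex → Chain R
  attach e [] = single 1# (e ∷ [])
  attach e (x ∷ τ) with proj₁ e <? proj₁ x
  ... | yes _ = single 1# (e ∷ x ∷ τ)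
  ... | no  _ = prepend⁻ x (attach e τ)

  detach : Edge → Simplex → Chain R
  detach e [] = []
  detach e (x ∷ σ) with x ≟ₑ e
  ... | yes _ = single 1# σ
  ... | no  _ = prepend⁻ x (detach e σ)

  attachᶜ : Edge → Chain R → Chain R
  attachᶜ e = bind (attach e)

  detachᶜ : Edge → Chain R → Chain R
  detachᶜ e = bind (detach e)

  attach-< : ∀ e τ → All (λ y → proj₁ e < proj₁ y) τ → attach e τ ≡ single 1# (e ∷ τ)
  attach-< e [] _ = refl
  attach-< e (x ∷ τ) (e<x ∷ _) with proj₁ e <? proj₁ x
  ... | yes _   = refl
  ... | no  e≮x = ⊥-elim (e≮x e<x)

  attach-≮ : ∀ e x ρ → ¬ proj₁ e < proj₁ x → attach e (x ∷ ρ) ≡ prepend⁻ x (attach e ρ)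
  attach-≮ e x ρ e≮x with proj₁ e <? proj₁ x
  ... | yes e<x = ⊥-elim (e≮x e<x)
  ... | no  _   = refl

  detach-head : ∀ e ρ → detach e (e ∷ ρ) ≡ single 1# ρ
  detach-head e ρ with e ≟ₑ e
  ... | yes _   = refl
  ... | no  e≢e = ⊥-elim (e≢e refl)

  detach-≢ : ∀ e x ρ → x ≢ e → detach e (x ∷ ρ) ≡ prepend⁻ x (detach e ρ)
  detach-≢ e x ρ x≢e with x ≟ₑ e
  ... | yes x≡e = ⊥-elim (x≢e x≡e)
  ... | no  _   = refl

  detach-∉ : ∀ e σ → e ∉ σ → detach e σ ≡ []
  detach-∉ e [] _ = refl
  detach-∉ e (x ∷ σ) e∉x∷σ with x ≟ₑ e
  ... | yes x≡e = ⊥-elim (e∉x∷σ (here (≡.sym x≡e)))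
  ... | no  _   = ≡.cong (prepend⁻ x) (detach-∉ e σ (e∉x∷σ ∘ there))

  attach-support : ∀ e τ → All (λ (_ , σ) → σ ≡ insert e τ) (attach e τ)
  attach-support e [] = refl ∷ []
  attach-support e (x ∷ τ) with proj₁ e <? proj₁ x
  ... | yes _ = refl ∷ []
  ... | no  _ = All.map⁺ (All.map (≡.cong (x ∷_)) (attach-support e τ))

  detach-support : ∀ e σ → All (λ (_ , ρ) → e ∈ σ × ρ ≡ remove e σ) (detach e σ)
  detach-support e [] = []
  detach-support e (x ∷ σ) with x ≟ₑ e
  ... | yes x≡e = (here (≡.sym x≡e) , refl) ∷ []
  ... | no  _   = All.map⁺ (All.map (λ (e∈σ , ρ≡) → there e∈σ , ≡.cong (x ∷_) ρ≡) (detach-support e σ))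

  private
    attachᶜ-faces-< : ∀ e τ → All (λ y → proj₁ e < proj₁ y) τ →
                      attachᶜ e (faces R τ) ≋ prepend e (faces R τ)
    attachᶜ-faces-< e τ e<τ = ≋-trans
      (bind-cong-on (faces R τ) (All.map (λ ρ⊆τ → ≡⇒≋ (attach-< e _ (All-resp-⊆ ρ⊆τ e<τ))) (faces-⊆ τ)))
      (bind-prepend e (faces R τ))

    attachᶜ-faces-≮ : ∀ e x τ → ¬ proj₁ e < proj₁ x →
                      attachᶜ e (faces R (x ∷ τ)) ≋ attach e τ ++ prepend x (attachᶜ e (faces R τ))
    attachᶜ-faces-≮ e x τ e≮x = ++-cong (scale-1 (attach e τ))
      (bind-prepend⁻-commute (attach e) (attach e) x (λ ρ → attach-≮ e x ρ e≮x) (faces R τ))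

  ∂-attach : ∀ e τ → Sorted τ → ∂ R (attach e τ) ≋ single 1# τ ++ neg (attachᶜ e (faces R τ))
  ∂-attach e [] _ = ∷-cong (*-identityˡ 1#) ≋-refl
  ∂-attach e (x ∷ τ) (x<τ ∷ τ-sorted) with proj₁ e <? proj₁ x
  ... | yes e<x = begin
    ∂ R (single 1# (e ∷ x ∷ τ))          ≈⟨ ∂-single (e ∷ x ∷ τ) ⟩
    S ++ prepend⁻ e (faces R (x ∷ τ))    ≈⟨ ++-congˡ S (prepend⁻≋neg-prepend e (faces R (x ∷ τ))) ⟩
    S ++ neg (prepend e (faces R (x ∷ τ))) ≈⟨ ++-congˡ S (neg-cong (attachᶜ-faces-< e (x ∷ τ) e<x∷τ)) ⟨
    S ++ neg (attachᶜ e (faces R (x ∷ τ))) ∎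
    where
    open SetoidReasoning ≋-setoid
    S : Chain R
    S = single 1# (x ∷ τ)
    e<x∷τ : All (λ y → proj₁ e < proj₁ y) (x ∷ τ)
    e<x∷τ = e<x ∷ All.map (<-trans e<x) x<τ
  ... | no e≮x = begin
    ∂ R (prepend⁻ x A)                          ≈⟨ ∂-prepend⁻ x A ⟩
    neg A ++ prepend x (∂ R A)                  ≈⟨ ++-congˡ (neg A) (prepend-cong x (∂-attach e τ τ-sorted)) ⟩
    neg A ++ prepend x (single 1# τ ++ neg B)   ≈⟨ ++-congˡ (neg A) (prepend-++ x (single 1# τ) (neg B)) ⟩
    neg A ++ (S ++ prepend x (neg B))           ≈⟨ ++-left-comm (neg A) S (prepend x (neg B)) ⟩
    S ++ (neg A ++ prepend x (neg B))           ≈⟨ ++-congˡ S (++-congˡ (neg A) (prepend-neg x B)) ⟩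
    S ++ (neg A ++ neg (prepend x B))           ≈⟨ ++-congˡ S (neg-++ A (prepend x B)) ⟨
    S ++ neg (A ++ prepend x B)                 ≈⟨ ++-congˡ S (neg-cong (attachᶜ-faces-≮ e x τ e≮x)) ⟨
    S ++ neg (attachᶜ e (faces R (x ∷ τ)))      ∎
    where
    open SetoidReasoning ≋-setoid
    S : Chain R
    S = single 1# (x ∷ τ)
    A : Chain R
    A = attach e τ
    B : Chain R
    B = attachᶜ e (faces R τ)

  ∂-attachᶜ : ∀ e w → All (λ (_ , τ) → Sorted τ) w → ∂ R (attachᶜ e w) ≋ w ++ neg (attachᶜ e (∂ R w))
  ∂-attachᶜ e w w-sorted = begin
    ∂ R (attachᶜ e w)                                  ≈⟨ ∂-bind (attach e) w ⟩
    bind (∂ R ∘ attach e) w                            ≈⟨ bind-cong-on w (All.map (∂-attach e _) w-sorted) ⟩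
    bind (λ τ → single 1# τ ++ neg (F τ)) w            ≈⟨ bind-++ᶠ (single 1#) (neg ∘ F) w ⟩
    bind (single 1#) w ++ bind (neg ∘ F) w             ≈⟨ ++-cong (bind-single w) (bind-negᶠ F w) ⟩
    w ++ neg (bind F w)                                ≈⟨ ++-congˡ w (neg-cong (bind-∂ (attach e) w)) ⟨
    w ++ neg (attachᶜ e (∂ R w))                       ∎
    where
    open SetoidReasoning ≋-setoid
    F : Simplex → Chain R
    F = attachᶜ e ∘ faces R

  detach-attach : ∀ e τ → e ∉ τ → detachᶜ e (attach e τ) ≋ single 1# τ
  detach-attach e [] _ = ≋-trans (bind-unit (detach e) (e ∷ [])) (≡⇒≋ (detach-head e []))
  detach-attach e (x ∷ τ) e∉x∷τ with proj₁ e <? proj₁ x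
  ... | yes _ = ≋-trans (bind-unit (detach e) (e ∷ x ∷ τ)) (≡⇒≋ (detach-head e (x ∷ τ)))
  ... | no  _ = ≋-trans
    (bind-prepend⁻-commute (detach e) (detach e) x (λ ρ → detach-≢ e x ρ (e∉x∷τ ∘ here ∘ ≡.sym)) (attach e τ))
    (prepend-cong x (detach-attach e τ (e∉x∷τ ∘ there)))

  detach-attach-≢ : ∀ e e′ τ → e ≢ e′ → e′ ∉ τ → detachᶜ e′ (attach e τ) ≋ []
  detach-attach-≢ e e′ [] e≢e′ _ = ≋-trans (bind-unit (detach e′) (e ∷ [])) (≡⇒≋ (detach-≢ e′ e [] e≢e′))
  detach-attach-≢ e e′ (x ∷ τ) e≢e′ e′∉x∷τ with proj₁ e <? proj₁ x
  ... | yes _ = ≋-trans (bind-unit (detach e′) (e ∷ x ∷ τ)) (≡⇒≋ (begin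
    detach e′ (e ∷ x ∷ τ)               ≡⟨ detach-≢ e′ e (x ∷ τ) e≢e′ ⟩
    prepend⁻ e (detach e′ (x ∷ τ))      ≡⟨ ≡.cong (prepend⁻ e) (detach-∉ e′ (x ∷ τ) e′∉x∷τ) ⟩
    []                                  ∎))
    where open ≡.≡-Reasoning
  ... | no  _ = ≋-trans
    (bind-prepend⁻-commute (detach e′) (detach e′) x (λ ρ → detach-≢ e′ x ρ (e′∉x∷τ ∘ here ∘ ≡.sym))
                           (attach e τ))
    (prepend-cong x (detach-attach-≢ e e′ τ e≢e′ (e′∉x∷τ ∘ there)))

  attach-detach : ∀ e σ → Sorted σ → e ∈ σ → attachᶜ e (detach e σ) ≋ single 1# σ
  attach-detach e (x ∷ σ) (x<σ ∷ σ-sorted) _ with x ≟ₑ e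
  ... | yes refl = ≋-trans (bind-unit (attach x) σ) (≡⇒≋ (attach-< x σ x<σ))
  attach-detach e (x ∷ σ) (x<σ ∷ σ-sorted) (here e≡x)  | no x≢e = ⊥-elim (x≢e (≡.sym e≡x))
  attach-detach e (x ∷ σ) (x<σ ∷ σ-sorted) (there e∈σ) | no _   = ≋-trans
    (bind-prepend⁻-commute (attach e) (attach e) x (λ ρ → attach-≮ e x ρ (<-asym (All.lookup x<σ e∈σ)))
                           (detach e σ))
    (prepend-cong x (attach-detach e σ σ-sorted e∈σ))

  detachᶜ-faces : ∀ e σ → Sorted σ → detachᶜ e (faces R σ) ≋ neg (∂ R (detach e σ))
  detachᶜ-faces e [] _ = ≋-refl
  detachᶜ-faces e (x ∷ σ) (x<σ ∷ σ-sorted) with x ≟ₑ e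
  ... | yes refl = begin
    scale R 1# (detach x σ) ++ detachᶜ x (prepend⁻ x (faces R σ))
      ≡⟨ ≡.cong (λ d → scale R 1# d ++ detachᶜ x (prepend⁻ x (faces R σ))) (detach-∉ x σ x∉σ) ⟩
    detachᶜ x (prepend⁻ x (faces R σ))
      ≈⟨ bind-prepend⁻ (detach x) (single 1#) (λ _ → []) x (detach-head x) (faces R σ) ⟩
    neg (bind (single 1#) (faces R σ)) ++ prepend x (bind (λ _ → []) (faces R σ))
      ≈⟨ ++-cong (neg-cong (bind-single (faces R σ))) (prepend-cong x (bind-[] (faces R σ))) ⟩
    neg (faces R σ) ++ []
      ≈⟨ ++-identityʳ _ ⟩
    neg (faces R σ)
      ≈⟨ neg-cong (∂-single σ) ⟨
    neg (∂ R (single 1# σ)) ∎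
    where
    open SetoidReasoning ≋-setoid
    x∉σ : x ∉ σ
    x∉σ x∈σ = <-irrefl refl (All.lookup x<σ x∈σ)
  ... | no x≢e = begin
    scale R 1# D ++ detachᶜ e (prepend⁻ x (faces R σ))
      ≈⟨ ++-cong (scale-1 D) (bind-prepend⁻-commute (detach e) (detach e) x (λ ρ → detach-≢ e x ρ x≢e) (faces R σ)) ⟩
    D ++ prepend x (detachᶜ e (faces R σ))
      ≈⟨ ++-congˡ D (prepend-cong x (detachᶜ-faces e σ σ-sorted)) ⟩
    D ++ prepend x (neg (∂ R D))
      ≈⟨ ++-congˡ D (prepend-neg x (∂ R D)) ⟩
    D ++ neg (prepend x (∂ R D))
      ≈⟨ ++-cong (neg-involutive D) ≋-refl ⟨
    neg (neg D) ++ neg (prepend x (∂ R D))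
      ≈⟨ neg-++ (neg D) (prepend x (∂ R D)) ⟨
    neg (neg D ++ prepend x (∂ R D))
      ≈⟨ neg-cong (∂-prepend⁻ x D) ⟨
    neg (∂ R (prepend⁻ x D)) ∎
    where
    open SetoidReasoning ≋-setoid
    D : Chain R
    D = detach e σ

  detachᶜ-∂ : ∀ e d → All (λ (_ , σ) → Sorted σ) d → detachᶜ e (∂ R d) ≋ neg (∂ R (detachᶜ e d))
  detachᶜ-∂ e d d-sorted = begin
    detachᶜ e (∂ R d)                       ≈⟨ bind-∂ (detach e) d ⟩
    bind (detachᶜ e ∘ faces R) d            ≈⟨ bind-cong-on d (All.map (detachᶜ-faces e _) d-sorted) ⟩
    bind (neg ∘ ∂ R ∘ detach e) d           ≈⟨ bind-negᶠ (∂ R ∘ detach e) d ⟩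
    neg (bind (∂ R ∘ detach e) d)           ≈⟨ neg-cong (∂-bind (detach e) d) ⟨
    neg (∂ R (detachᶜ e d))                 ∎
    where open SetoidReasoning ≋-setoid

module ReducedHomology {c ℓ : Level} (R : Ring c ℓ) where
  open Ring R renaming (refl to ≈-refl; sym to ≈-sym; trans to ≈-trans)
  open ChainAlgebra R

  On : (Simplex → Set) → Chain R → Set c
  On K = All (λ (_ , σ) → K σ)

  ChainIn-cast : ∀ {K d d′ c} → d ≡ d′ → ChainIn R K d c → ChainIn R K d′ c
  ChainIn-cast refl c∈K = c∈K

  ChainIn-mono : ∀ {K K′ : Complex} → (∀ {σ} → K σ → K′ σ) → ∀ d {c} → ChainIn R K d c → ChainIn R K′ d c
  ChainIn-mono K⊆K′ _ = All.map (λ (σ∈K , dim) → K⊆K′ σ∈K , dim)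

  ChainIn-neg : ∀ {K} d c → ChainIn R K d c → ChainIn R K d (neg c)
  ChainIn-neg _ = neg-support

  ChainIn-++ : ∀ {K} d a b → ChainIn R K d a → ChainIn R K d b → ChainIn R K d (a ++ b)
  ChainIn-++ _ _ _ = All.++⁺

  ChainIn⇒sorted : ∀ {S T} d c → ChainIn R (M S T) d c → On Sorted c
  ChainIn⇒sorted _ _ = All.map (λ ((match , _) , _) → matching⇒sorted match)

  ChainIn-Σᶜ : ∀ {K} d k (f : Fin k → Chain R) → (∀ i → ChainIn R K d (f i)) → ChainIn R K d (Σᶜ k f)
  ChainIn-Σᶜ _ = Σᶜ-support

  homologous : ∀ {K d} (x y : Cycle R K d) b → ChainIn R K (d ℤ.+ 1ℤ) b →
               ∂ R b ≋ chain x ++ neg (chain y) → FMod._≈_ (H̃ R K d) x y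
  homologous x y b b∈K ∂b≋x-y = b , b∈K , λ τ →
    ≈-trans (coeff-≈ ∂b≋x-y τ) (≈-trans (coeff-++ (chain x) (neg (chain y)) τ) (+-congˡ (coeff-neg (chain y) τ)))

  homologous⁻¹ : ∀ {K d} (x y : Cycle R K d) ((b , _) : FMod._≈_ (H̃ R K d) x y) →
                 ∂ R b ≋ chain x ++ neg (chain y)
  homologous⁻¹ x y (b , _ , ∂b≈x-y) = coeffwise λ τ →
    ≈-trans (∂b≈x-y τ) (≈-sym (≈-trans (coeff-++ (chain x) (neg (chain y)) τ) (+-congˡ (coeff-neg (chain y) τ))))

  ≋⇒homologous : ∀ {K d} (x y : Cycle R K d) → chain x ≋ chain y → FMod._≈_ (H̃ R K d) x y
  ≋⇒homologous x y x≋y = homologous x y [] [] (≋-sym (≋-trans (++-cong x≋y ≋-refl) (++-inverseʳ (chain y))))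

  cycle-∂ : ∀ {K d} (z : Cycle R K d) → ∂ R (chain z) ≋ []
  cycle-∂ z = coeffwise (cyc z)

module LongExactSequence {c ℓ : Level} (R : Ring c ℓ) (m n : ℕ) (1≤n : 1 ≤ n) where
  open Ring R renaming (refl to ≈-refl; sym to ≈-sym; trans to ≈-trans)
  open ChainAlgebra R
  open LinearExtension R
  open Boundary R
  open EdgeAttachment R
  open ReducedHomology R
  open MatchingComplexes m n 1≤n

  attachᵢ : Fin k → Chain R → Chain R
  attachᵢ i = attachᶜ (forbidden i)

  detachᵢ : Fin k → Chain R → Chain R
  detachᵢ i = detachᶜ (forbidden i)

  restrictΓ : Simplex → Chain R
  restrictΓ σ with any? forbidden? σ
  ... | yes _ = []
  ... | no  _ = single 1# σ

  restrictΓᶜ : Chain R → Chain R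
  restrictΓᶜ = bind restrictΓ

  decompose-simplex : ∀ σ → Mmn m n σ →
                      single 1# σ ≋ restrictΓ σ ++ Σᶜ k (λ i → attachᵢ i (detach (forbidden i) σ))
  decompose-simplex σ σ∈M@(match , _) with any? forbidden? σ
  ... | no σ-allowed = ≋-sym (≋-trans
    (++-congˡ (single 1# σ) (Σᶜ-vanishing k (λ i → ≡⇒≋ (≡.cong (attachᵢ i) (detach-∉ _ σ (fi∉σ i))))))
    (++-identityʳ _))
    where
    fi∉σ : ∀ i → forbidden i ∉ σ
    fi∉σ i = Γ⇒forbidden∉ i (σ∈M , All.¬Any⇒All¬ σ σ-allowed)
  ... | yes hit with find hit
  ... | e , e∈σ , e-forbidden with forbidden-surjective e-forbidden
  ... | i , refl = ≋-sym (≋-trans (Σᶜ-δ k i others) (attach-detach (forbidden i) σ (matching⇒sorted match) e∈σ))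
    where
    others : ∀ j → j ≢ i → attachᵢ j (detach (forbidden j) σ) ≋ []
    others j j≢i = ≡⇒≋ (≡.cong (attachᵢ j) (detach-∉ (forbidden j) σ
      (λ fj∈σ → j≢i (forbidden-injective (matching-right-unique match fj∈σ e∈σ refl)))))

  decompose : ∀ d → On (Mmn m n) d → d ≋ restrictΓᶜ d ++ Σᶜ k (λ i → attachᵢ i (detachᵢ i d))
  decompose d d∈M = begin
    d
      ≈⟨ bind-single d ⟨
    bind (single 1#) d
      ≈⟨ bind-cong-on d (All.map (decompose-simplex _) d∈M) ⟩
    bind (λ σ → restrictΓ σ ++ Σᶜ k (λ i → attachᵢ i (detach (forbidden i) σ))) d
      ≈⟨ bind-++ᶠ restrictΓ (λ σ → Σᶜ k (λ i → attachᵢ i (detach (forbidden i) σ))) d ⟩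
    restrictΓᶜ d ++ bind (λ σ → Σᶜ k (λ i → attachᵢ i (detach (forbidden i) σ))) d
      ≈⟨ ++-congˡ (restrictΓᶜ d) (bind-Σᶜᶠ k (λ i → attachᵢ i ∘ detach (forbidden i)) d) ⟩
    restrictΓᶜ d ++ Σᶜ k (λ i → bind (attachᵢ i ∘ detach (forbidden i)) d)
      ≈⟨ ++-congˡ (restrictΓᶜ d) (Σᶜ-cong k (λ i → bind-bind (attach (forbidden i)) (detach (forbidden i)) d)) ⟨
    restrictΓᶜ d ++ Σᶜ k (λ i → attachᵢ i (detachᵢ i d)) ∎
    where open SetoidReasoning ≋-setoid

  detachᵢ-Γ : ∀ i d → On (Γ m n) d → detachᵢ i d ≋ []
  detachᵢ-Γ i d d∈Γ =
    bind-vanishing d (All.map (λ σ∈Γ → ≡⇒≋ (detach-∉ (forbidden i) _ (Γ⇒forbidden∉ i σ∈Γ))) d∈Γ)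

  detachᵢ-attachᵢ : ∀ i w → On (Link i) w → detachᵢ i (attachᵢ i w) ≋ w
  detachᵢ-attachᵢ i w w∈Link = begin
    detachᵢ i (attachᵢ i w)                    ≈⟨ bind-bind (detach (forbidden i)) (attach (forbidden i)) w ⟩
    bind (detachᵢ i ∘ attach (forbidden i)) w  ≈⟨ bind-cong-on w (All.map fi-attach-detach w∈Link) ⟩
    bind (single 1#) w                         ≈⟨ bind-single w ⟩
    w                                          ∎
    where
    open SetoidReasoning ≋-setoid
    fi-attach-detach : ∀ {τ} → Link i τ → detachᵢ i (attach (forbidden i) τ) ≋ single 1# τ
    fi-attach-detach τ∈Link = detach-attach (forbidden i) _ (Γ⇒forbidden∉ i (Link⇒Γ i τ∈Link))

  detachᵢ-attachⱼ : ∀ i j w → j ≢ i → On (Link j) w → detachᵢ i (attachᵢ j w) ≋ []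
  detachᵢ-attachⱼ i j w j≢i w∈Link = ≋-trans
    (bind-bind (detach (forbidden i)) (attach (forbidden j)) w)
    (bind-vanishing w (All.map (λ τ∈Link → detach-attach-≢ (forbidden j) (forbidden i) _
                                  (j≢i ∘ forbidden-injective) (Γ⇒forbidden∉ i (Link⇒Γ j τ∈Link))) w∈Link))

  detachᵢ-Σattach : ∀ i (w : Fin k → Chain R) → (∀ j → On (Link j) (w j)) →
                    detachᵢ i (Σᶜ k (λ j → attachᵢ j (w j))) ≋ w i
  detachᵢ-Σattach i w w∈Link = ≋-trans (bind-Σᶜ (detach (forbidden i)) k (λ j → attachᵢ j (w j)))
    (≋-trans (Σᶜ-δ k i (λ j j≢i → detachᵢ-attachⱼ i j (w j) j≢i (w∈Link j))) (detachᵢ-attachᵢ i (w i) (w∈Link i)))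

  ∂-Σattach : ∀ (w : Fin k → Chain R) → (∀ j → On Sorted (w j)) →
              ∂ R (Σᶜ k (λ j → attachᵢ j (w j))) ≋ Σᶜ k (λ j → w j ++ neg (attachᵢ j (∂ R (w j))))
  ∂-Σattach w w-sorted = ≋-trans (∂-Σᶜ k (λ j → attachᵢ j (w j)))
    (Σᶜ-cong k (λ j → ∂-attachᶜ (forbidden j) (w j) (w-sorted j)))

  ∂-Σattach-cycles : ∀ (w : Fin k → Chain R) → (∀ j → On Sorted (w j)) → (∀ j → ∂ R (w j) ≋ []) →
                     ∂ R (Σᶜ k (λ j → attachᵢ j (w j))) ≋ Σᶜ k w
  ∂-Σattach-cycles w w-sorted w-cycles = ≋-trans (∂-Σattach w w-sorted)
    (Σᶜ-cong k (λ j → ≋-trans (++-congˡ (w j) (neg-≋[] (bind-cong (attach (forbidden j)) (w-cycles j))))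
                              (++-identityʳ (w j))))

  detachᵢ-∂ : ∀ i d → On (Mmn m n) d → detachᵢ i (∂ R d) ≋ neg (∂ R (detachᵢ i d))
  detachᵢ-∂ i d d∈M = detachᶜ-∂ (forbidden i) d (All.map (matching⇒sorted ∘ proj₁) d∈M)

  ∂-decompose : ∀ z → On (Mmn m n) z → (∀ j → ∂ R (detachᵢ j z) ≋ []) →
                ∂ R z ≋ ∂ R (restrictΓᶜ z) ++ Σᶜ k (λ j → detachᵢ j z)
  ∂-decompose z z∈M links-cycles = begin
    ∂ R z
      ≈⟨ ∂-cong (decompose z z∈M) ⟩
    ∂ R (restrictΓᶜ z ++ Σᶜ k (λ j → attachᵢ j (detachᵢ j z)))
      ≈⟨ ∂-++ (restrictΓᶜ z) _ ⟩
    ∂ R (restrictΓᶜ z) ++ ∂ R (Σᶜ k (λ j → attachᵢ j (detachᵢ j z)))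
      ≈⟨ ++-congˡ (∂ R (restrictΓᶜ z)) (∂-Σattach-cycles (λ j → detachᵢ j z) links-sorted links-cycles) ⟩
    ∂ R (restrictΓᶜ z) ++ Σᶜ k (λ j → detachᵢ j z) ∎
    where
    open SetoidReasoning ≋-setoid
    links-sorted : ∀ j → On Sorted (detachᵢ j z)
    links-sorted j = bind-support (detach (forbidden j)) z z∈M λ σ σ∈M →
      All.map (λ (fj∈σ , ρ≡) → ≡.subst Sorted (≡.sym ρ≡) (matching⇒sorted (proj₁ (remove-forbidden j σ∈M fj∈σ))))
              (detach-support (forbidden j) σ)

  ChainIn-attachᵢ : ∀ i d w → ChainIn R (Link i) d w → ChainIn R (Mmn m n) (d ℤ.+ 1ℤ) (attachᵢ i w)
  ChainIn-attachᵢ i d w w∈Link = bind-support (attach (forbidden i)) w w∈Link attach-in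
    where
    attach-in : ∀ τ → Link i τ × + length τ ≡ d ℤ.+ 1ℤ →
                All (λ (_ , σ) → Mmn m n σ × + length σ ≡ (d ℤ.+ 1ℤ) ℤ.+ 1ℤ) (attach (forbidden i) τ)
    attach-in τ (τ∈Link , dim) = All.map
      (λ σ≡ → ≡.subst (λ σ → Mmn m n σ × + length σ ≡ (d ℤ.+ 1ℤ) ℤ.+ 1ℤ) (≡.sym σ≡)
                (insert-forbidden i τ∈Link ,
                 ≡.trans (≡.cong +_ (length-insert (forbidden i) τ)) (≡.trans (+-suc _) (≡.cong (λ j → j ℤ.+ 1ℤ) dim))))
      (attach-support (forbidden i) τ)

  ChainIn-detachᵢ : ∀ i d c → ChainIn R (Mmn m n) (d ℤ.+ 1ℤ) c → ChainIn R (Link i) d (detachᵢ i c)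
  ChainIn-detachᵢ i d c c∈M = bind-support (detach (forbidden i)) c c∈M detach-in
    where
    detach-in : ∀ σ → Mmn m n σ × + length σ ≡ (d ℤ.+ 1ℤ) ℤ.+ 1ℤ →
                All (λ (_ , ρ) → Link i ρ × + length ρ ≡ d ℤ.+ 1ℤ) (detach (forbidden i) σ)
    detach-in σ (σ∈M , dim) = All.map
      (λ (fi∈σ , ρ≡) → ≡.subst (λ ρ → Link i ρ × + length ρ ≡ d ℤ.+ 1ℤ) (≡.sym ρ≡)
                (remove-forbidden i σ∈M fi∈σ ,
                 +1-injective (≡.trans (≡.sym (+-suc _)) (≡.trans (≡.cong +_ (length-remove fi∈σ)) dim))))
      (detach-support (forbidden i) σ)

  ChainIn-restrictΓᶜ : ∀ d c → ChainIn R (Mmn m n) d c → ChainIn R (Γ m n) d (restrictΓᶜ c)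
  ChainIn-restrictΓᶜ d c c∈M = bind-support restrictΓ c c∈M restrict
    where
    restrict : ∀ σ → Mmn m n σ × + length σ ≡ d ℤ.+ 1ℤ →
               All (λ (_ , ρ) → Γ m n ρ × + length ρ ≡ d ℤ.+ 1ℤ) (restrictΓ σ)
    restrict σ (σ∈M , dim) with any? forbidden? σ
    ... | yes _         = []
    ... | no  σ-allowed = ((σ∈M , All.¬Any⇒All¬ σ σ-allowed) , dim) ∷ []

  ∂-detachᵢ-vanishing : ∀ i c → On (Mmn m n) c → detachᵢ i (∂ R c) ≋ [] → ∂ R (detachᵢ i c) ≋ []
  ∂-detachᵢ-vanishing i c c∈M detach-∂c≋[] = begin
    ∂ R (detachᵢ i c)              ≈⟨ neg-involutive _ ⟨
    neg (neg (∂ R (detachᵢ i c)))  ≈⟨ neg-cong (detachᵢ-∂ i c c∈M) ⟨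
    neg (detachᵢ i (∂ R c))        ≈⟨ neg-≋[] detach-∂c≋[] ⟩
    []                             ∎
    where open SetoidReasoning ≋-setoid

  detachᵢ-cycle : ∀ i {d} (z : Cycle R (Mmn m n) d) → ∂ R (detachᵢ i (chain z)) ≋ []
  detachᵢ-cycle i z = ∂-detachᵢ-vanishing i (chain z) (All.map proj₁ (inK z))
    (bind-cong (detach (forbidden i)) (cycle-∂ z))

  αᶠ : ∀ d → FMod.Carrier (P̂ R m n d) → Cycle R (Γ m n) d
  αᶠ d w = cycle (Σᶜ k (chain ∘ w))
    (ChainIn-Σᶜ d k (chain ∘ w) (λ i → ChainIn-mono (Link⇒Γ i) d (inK (w i))))
    (coeff-≈ (≋-trans (∂-Σᶜ k (chain ∘ w)) (Σᶜ-vanishing k (cycle-∂ ∘ w))))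

  βᶠ : ∀ d → Cycle R (Γ m n) d → Cycle R (Mmn m n) d
  βᶠ d z = cycle (chain z) (ChainIn-mono proj₁ d (inK z)) (cyc z)

  δᶠ : ∀ d → Cycle R (Mmn m n) d → FMod.Carrier (P̂ R m n (d ℤ.- 1ℤ))
  δᶠ d z i = cycle (detachᵢ i (chain z))
    (ChainIn-detachᵢ i (d ℤ.- 1ℤ) (chain z) (ChainIn-cast (≡.sym ([i-1]+1≡i d)) (inK z)))
    (coeff-≈ (detachᵢ-cycle i z))

  α : ∀ d → LinMap R (P̂ R m n d) (H̃ R (Γ m n) d)
  α d = record
    { fun   = αᶠ d
    ; cong  = λ {x} {y} x≈y → homologous (αᶠ d x) (αᶠ d y) (Σᶜ k (λ i → proj₁ (x≈y i)))
        (ChainIn-Σᶜ (d ℤ.+ 1ℤ) k _ (λ i → ChainIn-mono (Link⇒Γ i) (d ℤ.+ 1ℤ) (proj₁ (proj₂ (x≈y i)))))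
        (begin
          ∂ R (Σᶜ k (λ i → proj₁ (x≈y i)))
            ≈⟨ ∂-Σᶜ k _ ⟩
          Σᶜ k (λ i → ∂ R (proj₁ (x≈y i)))
            ≈⟨ Σᶜ-cong k (λ i → homologous⁻¹ (x i) (y i) (x≈y i)) ⟩
          Σᶜ k (λ i → chain (x i) ++ neg (chain (y i)))
            ≈⟨ Σᶜ-++ k (chain ∘ x) (neg ∘ chain ∘ y) ⟩
          Σᶜ k (chain ∘ x) ++ Σᶜ k (neg ∘ chain ∘ y)
            ≈⟨ ++-congˡ (Σᶜ k (chain ∘ x)) (Σᶜ-neg k (chain ∘ y)) ⟩
          Σᶜ k (chain ∘ x) ++ neg (Σᶜ k (chain ∘ y)) ∎)
    ; +-hom = λ x y → ≋⇒homologous (αᶠ d (λ i → _+ᶜ_ R (x i) (y i))) (_+ᶜ_ R (αᶠ d x) (αᶠ d y))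
                        (Σᶜ-++ k (chain ∘ x) (chain ∘ y))
    ; ·-hom = λ r x → ≋⇒homologous (αᶠ d (λ i → _·ᶜ_ R r (x i))) (_·ᶜ_ R r (αᶠ d x))
                        (Σᶜ-scale r k (chain ∘ x))
    }
    where open SetoidReasoning ≋-setoid

  β : ∀ d → LinMap R (H̃ R (Γ m n) d) (H̃ R (Mmn m n) d)
  β d = record
    { fun   = βᶠ d
    ; cong  = λ (b , b∈Γ , ∂b≈x-y) → b , ChainIn-mono proj₁ (d ℤ.+ 1ℤ) b∈Γ , ∂b≈x-y
    ; +-hom = λ x y → ≋⇒homologous (βᶠ d (_+ᶜ_ R x y)) (_+ᶜ_ R (βᶠ d x) (βᶠ d y)) ≋-refl
    ; ·-hom = λ r x → ≋⇒homologous (βᶠ d (_·ᶜ_ R r x)) (_·ᶜ_ R r (βᶠ d x)) ≋-refl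
    }

  δ : ∀ d → LinMap R (H̃ R (Mmn m n) d) (P̂ R m n (d ℤ.- 1ℤ))
  δ d = record
    { fun   = δᶠ d
    ; cong  = λ {x} {y} x≈y@(b , b∈M , _) i → homologous (δᶠ d x i) (δᶠ d y i) (neg (detachᵢ i b))
        (ChainIn-neg ((d ℤ.- 1ℤ) ℤ.+ 1ℤ) _ (ChainIn-detachᵢ i ((d ℤ.- 1ℤ) ℤ.+ 1ℤ) b
          (ChainIn-cast (≡.cong (λ j → j ℤ.+ 1ℤ) (≡.sym ([i-1]+1≡i d))) b∈M)))
        (begin
          ∂ R (neg (detachᵢ i b))
            ≈⟨ ∂-neg (detachᵢ i b) ⟩
          neg (∂ R (detachᵢ i b))
            ≈⟨ detachᵢ-∂ i b (All.map proj₁ b∈M) ⟨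
          detachᵢ i (∂ R b)
            ≈⟨ bind-cong (detach (forbidden i)) (homologous⁻¹ x y x≈y) ⟩
          detachᵢ i (chain x ++ neg (chain y))
            ≈⟨ bind-++ (detach (forbidden i)) (chain x) (neg (chain y)) ⟩
          detachᵢ i (chain x) ++ detachᵢ i (neg (chain y))
            ≈⟨ ++-congˡ (detachᵢ i (chain x)) (bind-neg (detach (forbidden i)) (chain y)) ⟩
          detachᵢ i (chain x) ++ neg (detachᵢ i (chain y)) ∎)
    ; +-hom = λ x y i → ≋⇒homologous (δᶠ d (_+ᶜ_ R x y) i) (_+ᶜ_ R (δᶠ d x i) (δᶠ d y i))
                          (bind-++ (detach (forbidden i)) (chain x) (chain y))
    ; ·-hom = λ r x i → ≋⇒homologous (δᶠ d (_·ᶜ_ R r x) i) (_·ᶜ_ R r (δᶠ d x i))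
                          (bind-scale (detach (forbidden i)) r (chain x))
    }
    where open SetoidReasoning ≋-setoid

  β∘α≈0 : ∀ d x → FMod._≈_ (H̃ R (Mmn m n) d) (fun (β d) (fun (α d) x)) (0ᶜ R)
  β∘α≈0 d w = homologous (βᶠ d (αᶠ d w)) (0ᶜ R) (Σᶜ k (λ i → attachᵢ i (chain (w i))))
    (ChainIn-Σᶜ (d ℤ.+ 1ℤ) k _ (λ i → ChainIn-attachᵢ i d _ (inK (w i))))
    (≋-trans (∂-Σattach-cycles (chain ∘ w) (λ i → ChainIn⇒sorted d _ (inK (w i))) (cycle-∂ ∘ w))
             (≋-sym (++-identityʳ _)))

  ker-β⊆im-α : ∀ d y → FMod._≈_ (H̃ R (Mmn m n) d) (fun (β d) y) (0ᶜ R) →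
               Σ (FMod.Carrier (P̂ R m n d)) λ x → FMod._≈_ (H̃ R (Γ m n) d) (fun (α d) x) y
  ker-β⊆im-α d y βy≈0@(b , b∈M , _) = w , homologous (αᶠ d w) y (neg (restrictΓᶜ b))
    (ChainIn-neg (d ℤ.+ 1ℤ) _ (ChainIn-restrictΓᶜ (d ℤ.+ 1ℤ) b b∈M))
    (≋-trans (∂-neg (restrictΓᶜ b))
             (neg-of-summand (≋-trans (≋-sym ∂b≋y) (∂-decompose b (All.map proj₁ b∈M) links-cycles))))
    where
    ∂b≋y : ∂ R b ≋ chain y
    ∂b≋y = ≋-trans (homologous⁻¹ (βᶠ d y) (0ᶜ R) βy≈0) (++-identityʳ _)
    links-cycles : ∀ j → ∂ R (detachᵢ j b) ≋ []
    links-cycles j = ∂-detachᵢ-vanishing j b (All.map proj₁ b∈M)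
      (≋-trans (bind-cong (detach (forbidden j)) ∂b≋y) (detachᵢ-Γ j (chain y) (All.map proj₁ (inK y))))
    w : FMod.Carrier (P̂ R m n d)
    w j = cycle (detachᵢ j b) (ChainIn-detachᵢ j d b b∈M) (coeff-≈ (links-cycles j))

  δ∘β≈0 : ∀ d x → FMod._≈_ (P̂ R m n (d ℤ.- 1ℤ)) (fun (δ d) (fun (β d) x)) (λ _ → 0ᶜ R)
  δ∘β≈0 d x i = ≋⇒homologous (δᶠ d (βᶠ d x) i) (0ᶜ R) (detachᵢ-Γ i (chain x) (All.map proj₁ (inK x)))

  ker-δ⊆im-β : ∀ d y → FMod._≈_ (P̂ R m n (d ℤ.- 1ℤ)) (fun (δ d) y) (λ _ → 0ᶜ R) →
               Σ (Cycle R (Γ m n) d) λ x → FMod._≈_ (H̃ R (Mmn m n) d) (fun (β d) x) y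
  ker-δ⊆im-β d y δy≈0 = Yᶜ , homologous (βᶠ d Yᶜ) y (Σᶜ k (λ i → attachᵢ i (b i)))
    (ChainIn-Σᶜ (d ℤ.+ 1ℤ) k _ (λ i → ChainIn-attachᵢ i d (b i) (b∈Link i)))
    (begin
      ∂ R (Σᶜ k (λ i → attachᵢ i (b i)))
        ≈⟨ ∂-Σattach b (λ i → ChainIn⇒sorted d (b i) (b∈Link i)) ⟩
      Σᶜ k (λ i → b i ++ neg (attachᵢ i (∂ R (b i))))
        ≈⟨ Σᶜ-cong k (λ i → ++-congˡ (b i) (neg-cong (bind-cong (attach (forbidden i)) (∂b≋ i)))) ⟩
      Σᶜ k (λ i → b i ++ neg (A i))
        ≈⟨ Σᶜ-++ k b (neg ∘ A) ⟩
      Σᶜ k b ++ Σᶜ k (neg ∘ A)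
        ≈⟨ ++-congˡ (Σᶜ k b) (Σᶜ-neg k A) ⟩
      Σᶜ k b ++ neg (Σᶜ k A)
        ≈⟨ ++-neg-cancelˡ (restrictΓᶜ y′) (Σᶜ k b) (Σᶜ k A) ⟨
      Y ++ neg (restrictΓᶜ y′ ++ Σᶜ k A)
        ≈⟨ ++-congˡ Y (neg-cong (decompose y′ y′∈M)) ⟨
      Y ++ neg y′ ∎)
    where
    open SetoidReasoning ≋-setoid
    y′ : Chain R
    y′ = chain y
    y′∈M : On (Mmn m n) y′
    y′∈M = All.map proj₁ (inK y)
    A : Fin k → Chain R
    A i = attachᵢ i (detachᵢ i y′)
    b : Fin k → Chain R
    b i = proj₁ (δy≈0 i)
    b∈Link : ∀ i → ChainIn R (Link i) d (b i)
    b∈Link i = ChainIn-cast ([i-1]+1≡i d) (proj₁ (proj₂ (δy≈0 i)))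
    ∂b≋ : ∀ i → ∂ R (b i) ≋ detachᵢ i y′
    ∂b≋ i = ≋-trans (homologous⁻¹ (δᶠ d y i) (0ᶜ R) (δy≈0 i)) (++-identityʳ _)
    Y : Chain R
    Y = restrictΓᶜ y′ ++ Σᶜ k b
    Y-cycle : ∂ R Y ≋ []
    Y-cycle = begin
      ∂ R Y                                              ≈⟨ ∂-++ (restrictΓᶜ y′) (Σᶜ k b) ⟩
      ∂ R (restrictΓᶜ y′) ++ ∂ R (Σᶜ k b)                ≈⟨ ++-congˡ (∂ R (restrictΓᶜ y′)) (∂-Σᶜ k b) ⟩
      ∂ R (restrictΓᶜ y′) ++ Σᶜ k (∂ R ∘ b)              ≈⟨ ++-congˡ (∂ R (restrictΓᶜ y′)) (Σᶜ-cong k ∂b≋) ⟩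
      ∂ R (restrictΓᶜ y′) ++ Σᶜ k (λ i → detachᵢ i y′)    ≈⟨ ∂-decompose y′ y′∈M (λ i → detachᵢ-cycle i y) ⟨
      ∂ R y′                                             ≈⟨ cycle-∂ y ⟩
      []                                                 ∎
    Yᶜ : Cycle R (Γ m n) d
    Yᶜ = cycle Y
      (ChainIn-++ d _ _ (ChainIn-restrictΓᶜ d y′ (inK y))
                        (ChainIn-Σᶜ d k b (λ i → ChainIn-mono (Link⇒Γ i) d (b∈Link i))))
      (coeff-≈ Y-cycle)

  α∘δ≈0 : ∀ d x → FMod._≈_ (H̃ R (Γ m n) (d ℤ.- 1ℤ)) (fun (α (d ℤ.- 1ℤ)) (fun (δ d) x)) (0ᶜ R)
  α∘δ≈0 d x = homologous (αᶠ (d ℤ.- 1ℤ) (δᶠ d x)) (0ᶜ R) (neg (restrictΓᶜ (chain x)))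
    (ChainIn-cast (≡.sym ([i-1]+1≡i d)) (ChainIn-neg d _ (ChainIn-restrictΓᶜ d (chain x) (inK x))))
    (≋-trans (∂-neg (restrictΓᶜ (chain x))) (neg-of-summand (≋-trans (≋-sym (cycle-∂ x))
      (∂-decompose (chain x) (All.map proj₁ (inK x)) (λ j → detachᵢ-cycle j x)))))

  ker-α⊆im-δ : ∀ d y → FMod._≈_ (H̃ R (Γ m n) (d ℤ.- 1ℤ)) (fun (α (d ℤ.- 1ℤ)) y) (0ᶜ R) →
               Σ (Cycle R (Mmn m n) d) λ x → FMod._≈_ (P̂ R m n (d ℤ.- 1ℤ)) (fun (δ d) x) y
  ker-α⊆im-δ d w αw≈0@(c , c∈Γ′ , _) = Zᶜ , λ i → ≋⇒homologous (δᶠ d Zᶜ i) (w i) (begin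
      detachᵢ i (ΣA ++ neg c)              ≈⟨ bind-++ (detach (forbidden i)) ΣA (neg c) ⟩
      detachᵢ i ΣA ++ detachᵢ i (neg c)    ≈⟨ ++-cong (detachᵢ-Σattach i w′ (λ j → All.map proj₁ (inK (w j))))
                                                      (bind-neg (detach (forbidden i)) c) ⟩
      w′ i ++ neg (detachᵢ i c)            ≈⟨ ++-congˡ (w′ i) (neg-≋[] (detachᵢ-Γ i c (All.map proj₁ c∈Γ))) ⟩
      w′ i ++ []                           ≈⟨ ++-identityʳ (w′ i) ⟩
      w′ i                                 ∎)
    where
    open SetoidReasoning ≋-setoid
    w′ : Fin k → Chain R
    w′ = chain ∘ w
    ΣA : Chain R
    ΣA = Σᶜ k (λ j → attachᵢ j (w′ j))
    c∈Γ : ChainIn R (Γ m n) d c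
    c∈Γ = ChainIn-cast ([i-1]+1≡i d) c∈Γ′
    ∂c≋ : ∂ R c ≋ Σᶜ k w′
    ∂c≋ = ≋-trans (homologous⁻¹ (αᶠ (d ℤ.- 1ℤ) w) (0ᶜ R) αw≈0) (++-identityʳ _)
    Z-cycle : ∂ R (ΣA ++ neg c) ≋ []
    Z-cycle = begin
      ∂ R (ΣA ++ neg c)            ≈⟨ ∂-++ ΣA (neg c) ⟩
      ∂ R ΣA ++ ∂ R (neg c)        ≈⟨ ++-cong (∂-Σattach-cycles w′ (λ j → ChainIn⇒sorted (d ℤ.- 1ℤ) _ (inK (w j))) (cycle-∂ ∘ w))
                                              (≋-trans (∂-neg c) (neg-cong ∂c≋)) ⟩
      Σᶜ k w′ ++ neg (Σᶜ k w′)     ≈⟨ ++-inverseʳ (Σᶜ k w′) ⟩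
      []                           ∎
    Zᶜ : Cycle R (Mmn m n) d
    Zᶜ = cycle (ΣA ++ neg c)
      (ChainIn-++ d _ _
        (ChainIn-Σᶜ d k _ (λ j → ChainIn-cast ([i-1]+1≡i d) (ChainIn-attachᵢ j (d ℤ.- 1ℤ) (w′ j) (inK (w j)))))
        (ChainIn-neg d c (ChainIn-mono proj₁ d c∈Γ)))
      (coeff-≈ Z-cycle)

theorem2p3 : ∀ {c ℓ : Level} (R : Ring c ℓ) (m n : ℕ) → 1 ≤ m → 1 ≤ n →
    Σ ((d : ℤ) → LinMap R (P̂ R m n d) (H̃ R (Γ m n) d)) λ α →
    Σ ((d : ℤ) → LinMap R (H̃ R (Γ m n) d) (H̃ R (Mmn m n) d)) λ β →
    Σ ((d : ℤ) → LinMap R (H̃ R (Mmn m n) d) (P̂ R m n (d - 1ℤ))) λ δ →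
    ∀ (d : ℤ) → Exact R (α d) (β d) × Exact R (β d) (δ d) × Exact R (δ d) (α (d - 1ℤ))
theorem2p3 R m n _ 1≤n = α , β , δ , λ d →
    (β∘α≈0 d , ker-β⊆im-α d) , (δ∘β≈0 d , ker-δ⊆im-β d) , (α∘δ≈0 d , ker-α⊆im-δ d)
  where open LongExactSequence R m n 1≤n
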